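{- Let $\pi\in\{2143,2413,3142,3412\}$ and let $p=(\pi,R)$ with $R=(\{0,4\}\times[4])\cup([4]\times\{0,4\})$ (exactly the boundary boxes shaded). Then for every $n\ge4$, \[ s_n^+(p)=\binom{n-2}{2}^2(n-4)!\qquad\text{and}\qquad\lim_{n\to\infty}\frac{s_n^+(p)}{n!}=\frac14. \]
   Context: For $n\ge1$, $S_n$ is the set of permutations of $\{1,\dots,n\}$ in one-line notation $\tau=\tau_1\cdots\tau_n$. For an integer $k\ge0$ write $[k]=\{0,1,\dots,k\}$. A mesh pattern of length $k$ is a pair $(\pi,R)$ with $\pi\in S_k$ and $R\subseteq[k]\times[k]$; the elements $(x,y)\in R$ are the shaded boxes (box $(x,y)$ is the unit square with south-west corner $(x,y)$ in the plot of the points $(i,\pi_i)$). An occurrence of $(\pi,R)$ in $\tau\in S_n$ is a choice of positions $i_1<\dots<i_k$ such that $\tau_{i_a}<\tau_{i_b}$ iff $\pi_a<\pi_b$ for all $a,b$, and such that for every $(x,y)\in R$ there is no index $m$ with $i_x<m<i_{x+1}$ and $v_y<\tau_m<v_{y+1}$, where $i_0=0$, $i_{k+1}=n+1$, $v_0=0$, $v_{k+1}=n+1$, and for $1\le y\le k$, $v_y$ is the $y$-th smallest of the values $\tau_{i_1},\dots,\tau_{i_k}$. A permutation contains a mesh pattern if it has at least one occurrence of it, and $s_n^+(p)$ denotes the number of permutations in $S_n$ containing $p$. -}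

module Defs where

open import Data.Bool using (Bool; true; false; _∧_; not; if_then_else_)
open import Data.Nat using (ℕ; zero; suc; _+_; _*_; _∸_; _≡ᵇ_; _<ᵇ_; _!)
open import Data.Nat.Properties using (_!≢0)
open import Data.List using (List; []; _∷_; _++_; [_]; length; map; upTo; concatMap; filterᵇ)
open import Data.Bool.ListAction using (all; any)
open import Data.Product using (_×_; _,_)
open import Data.Integer using (+_)
open import Data.Rational using (ℚ; _/_)

-- Conventions: a permutation τ ∈ S_n is a list of length n of values in {1,…,n}
-- without repetitions (one-line notation).  Positions are 1-indexed.

_==_ : Bool → Bool → Bool
true  == b = b
false == b = not b

-- τ_m for 1 ≤ m ≤ length τ (1-indexed); 0 otherwise (never used out of range)
at : List ℕ → ℕ → ℕ
at []       _             = 0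
at (x ∷ xs) 0             = 0
at (x ∷ xs) 1             = x
at (x ∷ xs) (suc (suc m)) = at xs (suc m)

-- 0-indexed lookup, default 0
nth0 : List ℕ → ℕ → ℕ
nth0 []       _       = 0
nth0 (x ∷ xs) zero    = x
nth0 (x ∷ xs) (suc m) = nth0 xs m

range : ℕ → ℕ → List ℕ
range a b = map (λ i → a + i) (upTo (suc b ∸ a))

words : ℕ → List ℕ → List (List ℕ)
words zero    A = [] ∷ []
words (suc k) A = concatMap (λ a → map (a ∷_) (words k A)) A

insert : ℕ → List ℕ → List ℕ
insert x []       = x ∷ []
insert x (y ∷ ys) = if x <ᵇ suc y then x ∷ y ∷ ys else y ∷ insert x ys

sort : List ℕ → List ℕ
sort []       = []
sort (x ∷ xs) = insert x (sort xs)

distinct : List ℕ → Bool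
distinct τ = all (λ a → all (λ b → not (at τ a ≡ᵇ at τ b)) (range (suc a) (length τ)))
                 (range 1 (length τ))

S : ℕ → List (List ℕ)
S n = filterᵇ distinct (words n (range 1 n))

increasing : List ℕ → Bool
increasing []           = true
increasing (x ∷ [])     = true
increasing (x ∷ y ∷ xs) = (x <ᵇ y) ∧ increasing (y ∷ xs)

-- a mesh pattern (π , R): π in one-line notation, R the list of shaded boxes (x , y)
MeshPattern : Set
MeshPattern = List ℕ × List (ℕ × ℕ)

isOccurrence : ℕ → List ℕ → MeshPattern → List ℕ → Bool
isOccurrence n τ (π , R) is = iso ∧ shading
  where
  k : ℕ
  k = length π
  -- i_x for 0 ≤ x ≤ k+1, with i_0 = 0 and i_{k+1} = n+1
  I : ℕ → ℕ
  I x = nth0 (0 ∷ is ++ [ suc n ]) x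
  -- v_y for 0 ≤ y ≤ k+1, with v_0 = 0, v_{k+1} = n+1, v_y the y-th smallest occurrence value
  V : ℕ → ℕ
  V y = nth0 (0 ∷ sort (map (at τ) is) ++ [ suc n ]) y
  iso : Bool
  iso = all (λ a → all (λ b → (at τ (I a) <ᵇ at τ (I b)) == (at π a <ᵇ at π b))
                       (range 1 k)) (range 1 k)
  emptyBox : ℕ × ℕ → Bool
  emptyBox (x , y) =
    not (any (λ m → (I x <ᵇ m) ∧ (m <ᵇ I (suc x)) ∧ (V y <ᵇ at τ m) ∧ (at τ m <ᵇ V (suc y)))
             (range 1 n))
  shading : Bool
  shading = all emptyBox R

contains : ℕ → MeshPattern → List ℕ → Bool
contains n p τ =
  any (isOccurrence n τ p) (filterᵇ increasing (words (length (Data.Product.proj₁ p)) (range 1 n)))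

s⁺ : ℕ → MeshPattern → ℕ
s⁺ n p = length (filterᵇ (contains n p) (S n))

boundary4 : List (ℕ × ℕ)
boundary4 = concatMap (λ x → map (x ,_) (range 0 4)) (0 ∷ 4 ∷ [])
         ++ concatMap (λ x → map (x ,_) (0 ∷ 4 ∷ [])) (range 0 4)

patterns : List (List ℕ)
patterns = (2 ∷ 1 ∷ 4 ∷ 3 ∷ []) ∷ (2 ∷ 4 ∷ 1 ∷ 3 ∷ []) ∷ (3 ∷ 1 ∷ 4 ∷ 2 ∷ []) ∷ (3 ∷ 4 ∷ 1 ∷ 2 ∷ []) ∷ []

ratio : MeshPattern → ℕ → ℚ
ratio p n = (+ s⁺ n p) / (n !)
  where instance _ = n !≢0

{-# OPTIONS --safe #-}
module Submission where

-- Shading the whole boundary forces an occurrence to use the first and last positions and the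
-- values 1 and n.  As the middle letters of each of 2143, 2413, 3142, 3412 are its extreme ones,
-- τ contains the pattern exactly when τ₁ and τₙ are interior values comparing as π₁ and π₄ do,
-- and 1 and n occur in the order of π₂ and π₃.  Choosing the pair (τ₁ , τₙ) in C(n-2,2) ways,
-- exactly half of the (n-2)! arrangements of the remaining values put 1 and n in the right order,
-- so s_n^+ = C(n-2,2) (n-2)!/2 = C(n-2,2)² (n-4)!, and s_n^+/n! = (n-2)(n-3)/(4n(n-1)) → 1/4.

open import Defs

module Counting where

  open import Data.Bool using (Bool; true; false; _∧_; not; if_then_else_)
  open import Data.Bool.Properties using (∧-identityʳ; ∧-zeroʳ; ∧-conicalˡ; ∧-conicalʳ)
  open import Data.Bool.ListAction using (all; and)
  open import Data.Empty using (⊥-elim)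
  open import Data.List using (List; []; _∷_; _++_; [_]; length; map; upTo; applyUpTo; concatMap; filterᵇ)
  open import Data.List.Properties
    using (map-∘; map-applyUpTo; map-cong; map-++; upTo-∷ʳ; length-map; length-upTo; length-++; concatMap-cong)
  open import Data.List.Membership.Propositional using (_∈_)
  open import Data.List.Relation.Unary.Any using (here; there)
  open import Data.Nat using (ℕ; zero; suc; _+_; _*_; _∸_; _≡ᵇ_; _<ᵇ_; _≤ᵇ_; _≤_; _<_; z≤n; s≤s; _!; _⊓_; _^_)
  open import Data.Nat.Properties
  open import Data.Nat.Combinatorics using (_C_; nCk+nC[k+1]≡[n+1]C[k+1]; nC1≡n)
  open import Data.Nat.Solver using (module +-*-Solver)
  open +-*-Solver
  open import Function using (_∘_)
  open import Relation.Binary.Definitions using (tri<; tri≈; tri>)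
  open import Relation.Binary.PropositionalEquality hiding ([_])
  open import Relation.Nullary using (yes; no)

  toℕ : Bool → ℕ
  toℕ true = 1
  toℕ false = 0

  ≡ᵇ-refl : (n : ℕ) → (n ≡ᵇ n) ≡ true
  ≡ᵇ-refl zero = refl
  ≡ᵇ-refl (suc n) = ≡ᵇ-refl n

  ≡ᵇ-sym : (m n : ℕ) → (m ≡ᵇ n) ≡ (n ≡ᵇ m)
  ≡ᵇ-sym zero zero = refl
  ≡ᵇ-sym zero (suc n) = refl
  ≡ᵇ-sym (suc m) zero = refl
  ≡ᵇ-sym (suc m) (suc n) = ≡ᵇ-sym m n

  ≡ᵇ-sound : {m n : ℕ} → (m ≡ᵇ n) ≡ true → m ≡ n
  ≡ᵇ-sound {zero} {zero} e = refl
  ≡ᵇ-sound {suc m} {suc n} e = cong suc (≡ᵇ-sound e)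

  ≢⇒≡ᵇ-false : {m n : ℕ} → m ≢ n → (m ≡ᵇ n) ≡ false
  ≢⇒≡ᵇ-false {m} {n} m≢n with m ≡ᵇ n in e
  ... | true = ⊥-elim (m≢n (≡ᵇ-sound e))
  ... | false = refl

  ≡ᵇ-false⇒≢ : {m n : ℕ} → (m ≡ᵇ n) ≡ false → m ≢ n
  ≡ᵇ-false⇒≢ {m} e refl with trans (sym (≡ᵇ-refl m)) e
  ... | ()

  distinguishes : (p : ℕ → Bool) {a b : ℕ} → p a ≡ true → p b ≡ false → a ≢ b
  distinguishes p pa pb refl with trans (sym pa) pb
  ... | ()

  <ᵇ-true : {m n : ℕ} → m < n → (m <ᵇ n) ≡ true
  <ᵇ-true {zero} {suc n} _ = refl
  <ᵇ-true {suc m} {suc n} (s≤s m<n) = <ᵇ-true m<n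

  <ᵇ-false : {m n : ℕ} → n ≤ m → (m <ᵇ n) ≡ false
  <ᵇ-false {m} {zero} _ = refl
  <ᵇ-false {suc m} {suc n} (s≤s n≤m) = <ᵇ-false n≤m

  <ᵇ-sound : {m n : ℕ} → (m <ᵇ n) ≡ true → m < n
  <ᵇ-sound {zero} {suc n} _ = s≤s z≤n
  <ᵇ-sound {suc m} {suc n} e = s≤s (<ᵇ-sound e)

  <ᵇ-irrefl : (n : ℕ) → (n <ᵇ n) ≡ false
  <ᵇ-irrefl n = <ᵇ-false {n} {n} ≤-refl

  module _ {X : Set} where

    count : (X → Bool) → List X → ℕ
    count p xs = length (filterᵇ p xs)

    sumMap : (X → ℕ) → List X → ℕ
    sumMap F [] = 0
    sumMap F (x ∷ xs) = F x + sumMap F xs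

    filterᵇ-∷ : (p : X → Bool) (x : X) (xs : List X) →
      filterᵇ p (x ∷ xs) ≡ (if p x then x ∷ filterᵇ p xs else filterᵇ p xs)
    filterᵇ-∷ p x xs with p x
    ... | true = refl
    ... | false = refl

    filterᵇ-++ : (p : X → Bool) (xs ys : List X) → filterᵇ p (xs ++ ys) ≡ filterᵇ p xs ++ filterᵇ p ys
    filterᵇ-++ p [] ys = refl
    filterᵇ-++ p (x ∷ xs) ys rewrite filterᵇ-∷ p x (xs ++ ys) | filterᵇ-∷ p x xs with p x
    ... | true = cong (x ∷_) (filterᵇ-++ p xs ys)
    ... | false = filterᵇ-++ p xs ys

    filterᵇ-cong : {p q : X → Bool} → (∀ x → p x ≡ q x) → (xs : List X) → filterᵇ p xs ≡ filterᵇ q xs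
    filterᵇ-cong e [] = refl
    filterᵇ-cong {p} {q} e (x ∷ xs) rewrite filterᵇ-∷ p x xs | filterᵇ-∷ q x xs | e x | filterᵇ-cong e xs = refl

    filterᵇ-filterᵇ : (p q : X → Bool) (xs : List X) → filterᵇ p (filterᵇ q xs) ≡ filterᵇ (λ x → q x ∧ p x) xs
    filterᵇ-filterᵇ p q [] = refl
    filterᵇ-filterᵇ p q (x ∷ xs) rewrite filterᵇ-∷ q x xs | filterᵇ-∷ (λ x → q x ∧ p x) x xs with q x
    ... | false = filterᵇ-filterᵇ p q xs
    ... | true rewrite filterᵇ-∷ p x (filterᵇ q xs) with p x
    ...   | true = cong (x ∷_) (filterᵇ-filterᵇ p q xs)
    ...   | false = filterᵇ-filterᵇ p q xs

    filterᵇ-none : (p : X → Bool) (xs : List X) → (∀ x → p x ≡ false) → filterᵇ p xs ≡ []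
    filterᵇ-none p [] _ = refl
    filterᵇ-none p (x ∷ xs) e rewrite filterᵇ-∷ p x xs | e x = filterᵇ-none p xs e

    count-∷ : (p : X → Bool) (x : X) (xs : List X) → count p (x ∷ xs) ≡ toℕ (p x) + count p xs
    count-∷ p x xs rewrite filterᵇ-∷ p x xs with p x
    ... | true = refl
    ... | false = refl

    count-++ : (p : X → Bool) (xs ys : List X) → count p (xs ++ ys) ≡ count p xs + count p ys
    count-++ p xs ys rewrite filterᵇ-++ p xs ys = length-++ (filterᵇ p xs)

    count-cong : {p q : X → Bool} → (∀ x → p x ≡ q x) → (xs : List X) → count p xs ≡ count q xs
    count-cong e xs = cong length (filterᵇ-cong e xs)

    count-cong-∈ : {p q : X → Bool} (xs : List X) → (∀ x → x ∈ xs → p x ≡ q x) → count p xs ≡ count q xs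
    count-cong-∈ [] e = refl
    count-cong-∈ {p} {q} (x ∷ xs) e rewrite count-∷ p x xs | count-∷ q x xs | e x (here refl) =
      cong (toℕ (q x) +_) (count-cong-∈ xs (λ y y∈ → e y (there y∈)))

    count-none : (p : X → Bool) (xs : List X) → (∀ x → p x ≡ false) → count p xs ≡ 0
    count-none p xs e = cong length (filterᵇ-none p xs e)

    count-filterᵇ : (q p : X → Bool) (xs : List X) → count p (filterᵇ q xs) ≡ count (λ z → q z ∧ p z) xs
    count-filterᵇ q p xs = cong length (filterᵇ-filterᵇ p q xs)

    length≡count+count-not : (q : X → Bool) (xs : List X) → length xs ≡ count q xs + count (not ∘ q) xs
    length≡count+count-not q [] = refl
    length≡count+count-not q (x ∷ xs) rewrite count-∷ q x xs | count-∷ (not ∘ q) x xs with q x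
    ... | true = cong suc (length≡count+count-not q xs)
    ... | false = trans (cong suc (length≡count+count-not q xs)) (sym (+-suc _ _))

    count-split : (q p : X → Bool) (xs : List X) →
      count p xs ≡ count (λ z → q z ∧ p z) xs + count (λ z → not (q z) ∧ p z) xs
    count-split q p [] = refl
    count-split q p (x ∷ xs)
      rewrite count-∷ p x xs | count-∷ (λ z → q z ∧ p z) x xs | count-∷ (λ z → not (q z) ∧ p z) x xs
            | count-split q p xs
      with q x | p x
    ... | true | true = refl
    ... | true | false = refl
    ... | false | true = sym (+-suc _ _)
    ... | false | false = refl

    count-∧-≤ : (q p : X → Bool) (xs : List X) → count (λ z → q z ∧ p z) xs ≤ count p xs
    count-∧-≤ q p xs rewrite count-split q p xs = m≤m+n _ _

    sumMap-cong : {F G : X → ℕ} (xs : List X) → (∀ x → x ∈ xs → F x ≡ G x) → sumMap F xs ≡ sumMap G xs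
    sumMap-cong [] e = refl
    sumMap-cong (x ∷ xs) e = cong₂ _+_ (e x (here refl)) (sumMap-cong xs (λ y y∈ → e y (there y∈)))

    sumMap-+ : (F G : X → ℕ) (xs : List X) → sumMap (λ x → F x + G x) xs ≡ sumMap F xs + sumMap G xs
    sumMap-+ F G [] = refl
    sumMap-+ F G (x ∷ xs) rewrite sumMap-+ F G xs =
      solve 4 (λ a b c d → a :+ b :+ (c :+ d) := a :+ c :+ (b :+ d)) refl (F x) (G x) (sumMap F xs) (sumMap G xs)

    sumMap-*ʳ : (F : X → ℕ) (m : ℕ) (xs : List X) → sumMap (λ x → F x * m) xs ≡ sumMap F xs * m
    sumMap-*ʳ F m [] = refl
    sumMap-*ʳ F m (x ∷ xs) rewrite sumMap-*ʳ F m xs = sym (*-distribʳ-+ m (F x) _)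

    sumMap-*ˡ : (F : X → ℕ) (m : ℕ) (xs : List X) → sumMap (λ x → m * F x) xs ≡ m * sumMap F xs
    sumMap-*ˡ F m [] = sym (*-zeroʳ m)
    sumMap-*ˡ F m (x ∷ xs) rewrite sumMap-*ˡ F m xs = sym (*-distribˡ-+ m (F x) _)

    sumMap-toℕ : (p : X → Bool) (xs : List X) → sumMap (toℕ ∘ p) xs ≡ count p xs
    sumMap-toℕ p [] = refl
    sumMap-toℕ p (x ∷ xs) rewrite count-∷ p x xs = cong (toℕ (p x) +_) (sumMap-toℕ p xs)

    sumMap-const : (m : ℕ) (xs : List X) → sumMap (λ _ → m) xs ≡ length xs * m
    sumMap-const m [] = refl
    sumMap-const m (x ∷ xs) = cong (m +_) (sumMap-const m xs)

  module _ {X Y : Set} where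

    filterᵇ-map : (p : Y → Bool) (f : X → Y) (xs : List X) → filterᵇ p (map f xs) ≡ map f (filterᵇ (p ∘ f) xs)
    filterᵇ-map p f [] = refl
    filterᵇ-map p f (x ∷ xs) rewrite filterᵇ-∷ p (f x) (map f xs) | filterᵇ-∷ (p ∘ f) x xs with p (f x)
    ... | true = cong (f x ∷_) (filterᵇ-map p f xs)
    ... | false = filterᵇ-map p f xs

    filterᵇ-concatMap : (p : Y → Bool) (G : X → List Y) (xs : List X) →
      filterᵇ p (concatMap G xs) ≡ concatMap (filterᵇ p ∘ G) xs
    filterᵇ-concatMap p G [] = refl
    filterᵇ-concatMap p G (x ∷ xs) =
      trans (filterᵇ-++ p (G x) (concatMap G xs)) (cong (filterᵇ p (G x) ++_) (filterᵇ-concatMap p G xs))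

    concatMap-filterᵇ : (q : X → Bool) (G : X → List Y) (xs : List X) →
      concatMap G (filterᵇ q xs) ≡ concatMap (λ x → if q x then G x else []) xs
    concatMap-filterᵇ q G [] = refl
    concatMap-filterᵇ q G (x ∷ xs) rewrite filterᵇ-∷ q x xs with q x
    ... | true = cong (G x ++_) (concatMap-filterᵇ q G xs)
    ... | false = concatMap-filterᵇ q G xs

    count-map : (p : Y → Bool) (f : X → Y) (xs : List X) → count p (map f xs) ≡ count (p ∘ f) xs
    count-map p f xs rewrite filterᵇ-map p f xs = length-map f (filterᵇ (p ∘ f) xs)

    count-concatMap : (p : Y → Bool) (G : X → List Y) (xs : List X) →
      count p (concatMap G xs) ≡ sumMap (count p ∘ G) xs
    count-concatMap p G [] = refl
    count-concatMap p G (x ∷ xs) =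
      trans (count-++ p (G x) (concatMap G xs)) (cong (count p (G x) +_) (count-concatMap p G xs))

  filterᵇ-all-words : (q : ℕ → Bool) (k : ℕ) (A : List ℕ) → filterᵇ (all q) (words k A) ≡ words k (filterᵇ q A)
  filterᵇ-all-words q zero A = refl
  filterᵇ-all-words q (suc k) A =
    trans (filterᵇ-concatMap (all q) (λ a → map (a ∷_) (words k A)) A)
    (trans (concatMap-cong byHead A) (sym (concatMap-filterᵇ q (λ a → map (a ∷_) (words k (filterᵇ q A))) A)))
    where
    byHead : (a : ℕ) →
      filterᵇ (all q) (map (a ∷_) (words k A)) ≡ (if q a then map (a ∷_) (words k (filterᵇ q A)) else [])
    byHead a rewrite filterᵇ-map (all q) (a ∷_) (words k A) with q a
    ... | true = cong (map (a ∷_)) (filterᵇ-all-words q k A)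
    ... | false = cong (map (a ∷_)) (filterᵇ-none _ (words k A) (λ _ → refl))

  all-cong : {X : Set} {h h′ : X → Bool} → (∀ x → h x ≡ h′ x) → (xs : List X) → all h xs ≡ all h′ xs
  all-cong e xs = cong and (map-cong e xs)

  all-applyUpTo : (h : ℕ → Bool) (f : ℕ → ℕ) (n : ℕ) → all h (applyUpTo f n) ≡ all (h ∘ f) (upTo n)
  all-applyUpTo h f n =
    trans (cong and (map-applyUpTo f h n)) (sym (cong and (map-applyUpTo (λ i → i) (h ∘ f) n)))

  all-at : (g : ℕ → Bool) (w : List ℕ) → all (λ i → g (at w (suc i))) (upTo (length w)) ≡ all g w
  all-at g [] = refl
  all-at g (x ∷ xs) =
    cong (g x ∧_) (trans (all-applyUpTo (λ i → g (at (x ∷ xs) (suc i))) suc (length xs)) (all-at g xs))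

  all-range : (h : ℕ → Bool) (a b : ℕ) → all h (range (suc a) b) ≡ all (λ i → h (suc (a + i))) (upTo (b ∸ a))
  all-range h a b = cong and (sym (map-∘ (upTo (suc b ∸ suc a))))

  distinct-∷ : (c : ℕ) (w : List ℕ) → distinct (c ∷ w) ≡ (all (λ z → not (c ≡ᵇ z)) w ∧ distinct w)
  distinct-∷ c w =
    trans (all-range fromCons 0 (suc L))
    (trans (cong (fromCons 1 ∧_) (all-applyUpTo (fromCons ∘ suc) suc L))
    (cong₂ _∧_ (trans (all-range _ 1 (suc L)) (all-at (λ z → not (c ≡ᵇ z)) w))
      (trans (all-cong shift (upTo L)) (sym (all-range fromTail 0 L)))))
    where
    L = length w
    fromCons : ℕ → Bool
    fromCons a = all (λ b → not (at (c ∷ w) a ≡ᵇ at (c ∷ w) b)) (range (suc a) (suc L))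
    fromTail : ℕ → Bool
    fromTail a = all (λ b → not (at w a ≡ᵇ at w b)) (range (suc a) L)
    shift : (i : ℕ) → fromCons (suc (suc i)) ≡ fromTail (suc i)
    shift i = trans (all-range _ (suc (suc i)) (suc L)) (sym (all-range _ (suc i) L))

  remove : ℕ → List ℕ → List ℕ
  remove c A = filterᵇ (λ z → not (c ≡ᵇ z)) A

  injWords : ℕ → List ℕ → List (List ℕ)
  injWords k A = filterᵇ distinct (words k A)

  injWords-suc : (k : ℕ) (A : List ℕ) →
    injWords (suc k) A ≡ concatMap (λ c → map (c ∷_) (injWords k (remove c A))) A
  injWords-suc k A =
    trans (filterᵇ-concatMap distinct (λ a → map (a ∷_) (words k A)) A) (concatMap-cong byHead A)
    where
    byHead : (c : ℕ) → filterᵇ distinct (map (c ∷_) (words k A)) ≡ map (c ∷_) (injWords k (remove c A))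
    byHead c = trans (filterᵇ-map distinct (c ∷_) (words k A))
      (cong (map (c ∷_)) (trans (filterᵇ-cong (distinct-∷ c) (words k A))
        (trans (sym (filterᵇ-filterᵇ distinct (all (λ z → not (c ≡ᵇ z))) (words k A)))
          (cong (filterᵇ distinct) (filterᵇ-all-words (λ z → not (c ≡ᵇ z)) k A)))))

  count-injWords-suc : (P : List ℕ → Bool) (k : ℕ) (A : List ℕ) →
    count P (injWords (suc k) A) ≡ sumMap (λ c → count (P ∘ (c ∷_)) (injWords k (remove c A))) A
  count-injWords-suc P k A rewrite injWords-suc k A =
    trans (count-concatMap P _ A) (sumMap-cong A (λ c _ → count-map P (c ∷_) (injWords k (remove c A))))

  count-injWords-cong : (P Q : List ℕ → Bool) (k : ℕ) (A : List ℕ) → (∀ d w → P (d ∷ w) ≡ Q (d ∷ w)) →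
    count P (injWords (suc k) A) ≡ count Q (injWords (suc k) A)
  count-injWords-cong P Q k A e =
    trans (count-injWords-suc P k A)
    (trans (sumMap-cong A (λ c _ → count-cong (e c) (injWords k (remove c A))))
    (sym (count-injWords-suc Q k A)))

  Once : ℕ → List ℕ → Set
  Once x B = count (x ≡ᵇ_) B ≡ 1

  NoDup : List ℕ → Set
  NoDup B = (z : ℕ) → count (z ≡ᵇ_) B ≤ 1

  ∈⇒Once : {x : ℕ} {B : List ℕ} → NoDup B → x ∈ B → Once x B
  ∈⇒Once {x} {B} nd x∈B = ≤-antisym (nd x) (atLeastOnce B x∈B)
    where
    atLeastOnce : (B : List ℕ) → x ∈ B → 1 ≤ count (x ≡ᵇ_) B
    atLeastOnce (y ∷ B) (here refl) rewrite count-∷ (x ≡ᵇ_) x B | ≡ᵇ-refl x = s≤s z≤n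
    atLeastOnce (y ∷ B) (there x∈B) rewrite count-∷ (x ≡ᵇ_) y B = ≤-trans (atLeastOnce B x∈B) (m≤n+m _ _)

  Once-singleton : {x : ℕ} (b : ℕ) → Once x (b ∷ []) → x ≡ b
  Once-singleton {x} b once with x ≡ᵇ b in e
  ... | true = ≡ᵇ-sound e

  length-remove : (c : ℕ) (B : List ℕ) → Once c B → length B ≡ suc (length (remove c B))
  length-remove c B once = trans (length≡count+count-not (c ≡ᵇ_) B) (cong (_+ length (remove c B)) once)

  count-remove : (c : ℕ) (g : ℕ → Bool) (B : List ℕ) → Once c B → count g (remove c B) + toℕ (g c) ≡ count g B
  count-remove c g B once = trans (+-comm _ (toℕ (g c))) (sym (trans (count-split (c ≡ᵇ_) g B)
     (cong₂ _+_ atC (sym (count-filterᵇ (λ z → not (c ≡ᵇ z)) g B)))))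
    where
    onlyC : (z : ℕ) → ((c ≡ᵇ z) ∧ g z) ≡ ((c ≡ᵇ z) ∧ g c)
    onlyC z with c ≡ᵇ z in e
    ... | true = cong g (sym (≡ᵇ-sound e))
    ... | false = refl
    atC : count (λ z → (c ≡ᵇ z) ∧ g z) B ≡ toℕ (g c)
    atC rewrite count-cong onlyC B with g c
    ... | true = trans (count-cong (λ z → ∧-identityʳ (c ≡ᵇ z)) B) once
    ... | false = count-none _ B (λ z → ∧-zeroʳ (c ≡ᵇ z))

  Once-remove : {x : ℕ} (c : ℕ) (B : List ℕ) → Once x B → c ≢ x → Once x (remove c B)
  Once-remove {x} c B once c≢x =
    trans (count-filterᵇ (λ z → not (c ≡ᵇ z)) (x ≡ᵇ_) B) (trans (count-cong keepX B) once)
    where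
    keepX : (z : ℕ) → (not (c ≡ᵇ z) ∧ (x ≡ᵇ z)) ≡ (x ≡ᵇ z)
    keepX z with x ≡ᵇ z in e
    ... | false = ∧-zeroʳ _
    ... | true = cong (λ b → not b ∧ true) (trans (cong (c ≡ᵇ_) (sym (≡ᵇ-sound e))) (≢⇒≡ᵇ-false c≢x))

  NoDup-remove : (c : ℕ) (B : List ℕ) → NoDup B → NoDup (remove c B)
  NoDup-remove c B nd z = ≤-trans (≤-reflexive (count-filterᵇ (λ y → not (c ≡ᵇ y)) (z ≡ᵇ_) B))
    (≤-trans (count-∧-≤ (λ y → not (c ≡ᵇ y)) (z ≡ᵇ_) B) (nd z))

  length-remove-suc : {k : ℕ} (c : ℕ) (B : List ℕ) → Once c B → length B ≡ suc k → length (remove c B) ≡ k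
  length-remove-suc c B once len = suc-injective (trans (sym (length-remove c B once)) len)

  count-remove-false : (c : ℕ) (g : ℕ → Bool) (B : List ℕ) → Once c B → g c ≡ false → count g (remove c B) ≡ count g B
  count-remove-false c g B once gc =
    trans (sym (+-identityʳ _)) (trans (cong (λ b → count g (remove c B) + toℕ b) (sym gc)) (count-remove c g B once))

  last : List ℕ → ℕ
  last [] = 0
  last (x ∷ []) = x
  last (x ∷ y ∷ w) = last (y ∷ w)

  position : ℕ → List ℕ → ℕ
  position z [] = 0
  position z (c ∷ w) = if c ≡ᵇ z then 0 else suc (position z w)

  before : ℕ → ℕ → List ℕ → Bool
  before x y w = position x w <ᵇ position y w

  count-injWords-last : (g : ℕ → Bool) (k : ℕ) (B : List ℕ) → NoDup B → length B ≡ suc k →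
    count (g ∘ last) (injWords (suc k) B) ≡ count g B * k !
  count-injWords-last g zero (b ∷ []) nd refl
    rewrite count-injWords-suc (g ∘ last) zero (b ∷ []) | count-∷ g b [] with g b
  ... | true = refl
  ... | false = refl
  count-injWords-last g (suc k) B nd len =
    begin
      count (g ∘ last) (injWords (suc (suc k)) B)
    ≡⟨ count-injWords-suc (g ∘ last) (suc k) B ⟩
      sumMap (λ c → count (g ∘ last ∘ (c ∷_)) (injWords (suc k) (remove c B))) B
    ≡⟨ sumMap-cong B byHead ⟩
      sumMap (λ c → count g (remove c B) * k !) B
    ≡⟨ sumMap-*ʳ (λ c → count g (remove c B)) (k !) B ⟩
      sumMap (λ c → count g (remove c B)) B * k !
    ≡⟨ cong (_* k !) (+-cancelʳ-≡ (count g B) _ _ removals) ⟩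
      suc k * count g B * k !
    ≡⟨ solve 3 (λ k r f → (con 1 :+ k) :* r :* f := r :* ((con 1 :+ k) :* f)) refl k (count g B) (k !) ⟩
      count g B * suc k !
    ∎
    where
    open ≡-Reasoning
    byHead : (c : ℕ) → c ∈ B →
      count (g ∘ last ∘ (c ∷_)) (injWords (suc k) (remove c B)) ≡ count g (remove c B) * k !
    byHead c c∈B = trans (count-injWords-cong _ _ k (remove c B) (λ d w → refl))
      (count-injWords-last g k (remove c B) (NoDup-remove c B nd) (length-remove-suc c B (∈⇒Once nd c∈B) len))
    -- each c with g c is missed by exactly one of the removals
    removals : sumMap (λ c → count g (remove c B)) B + count g B ≡ suc k * count g B + count g B
    removals =
      begin
        sumMap (λ c → count g (remove c B)) B + count g B
      ≡⟨ cong (sumMap (λ c → count g (remove c B)) B +_) (sym (sumMap-toℕ g B)) ⟩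
        sumMap (λ c → count g (remove c B)) B + sumMap (toℕ ∘ g) B
      ≡⟨ sym (sumMap-+ (λ c → count g (remove c B)) (toℕ ∘ g) B) ⟩
        sumMap (λ c → count g (remove c B) + toℕ (g c)) B
      ≡⟨ sumMap-cong B (λ c c∈B → count-remove c g B (∈⇒Once nd c∈B)) ⟩
        sumMap (λ _ → count g B) B
      ≡⟨ trans (sumMap-const (count g B) B) (cong (_* count g B) len) ⟩
        suc (suc k) * count g B
      ≡⟨ +-comm (count g B) (suc k * count g B) ⟩
        suc k * count g B + count g B
      ∎

  lastAndBefore : (ℕ → Bool) → ℕ → ℕ → List ℕ → Bool
  lastAndBefore g x y w = g (last w) ∧ before x y w

  lastAndBefore-head-first : (g : ℕ → Bool) (x y d : ℕ) (w : List ℕ) → x ≢ y →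
    lastAndBefore g x y (x ∷ d ∷ w) ≡ g (last (d ∷ w))
  lastAndBefore-head-first g x y d w x≢y rewrite ≡ᵇ-refl x | ≢⇒≡ᵇ-false x≢y = ∧-identityʳ _

  lastAndBefore-head-second : (g : ℕ → Bool) (x y d : ℕ) (w : List ℕ) →
    lastAndBefore g x y (y ∷ d ∷ w) ≡ false
  lastAndBefore-head-second g x y d w rewrite ≡ᵇ-refl y = ∧-zeroʳ _

  lastAndBefore-head-other : (g : ℕ → Bool) (x y c d : ℕ) (w : List ℕ) → c ≢ x → c ≢ y →
    lastAndBefore g x y (c ∷ d ∷ w) ≡ lastAndBefore g x y (d ∷ w)
  lastAndBefore-head-other g x y c d w c≢x c≢y rewrite ≢⇒≡ᵇ-false c≢x | ≢⇒≡ᵇ-false c≢y = refl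

  count-lastAndBefore-first : (g : ℕ → Bool) (x y k : ℕ) (B : List ℕ) → NoDup B → length B ≡ suc (suc k) →
    Once x B → x ≢ y → g x ≡ false →
    count (lastAndBefore g x y ∘ (x ∷_)) (injWords (suc k) (remove x B)) ≡ count g B * k !
  count-lastAndBefore-first g x y k B nd len onceX x≢y gx =
    trans (count-injWords-cong _ (g ∘ last) k (remove x B) (λ d w → lastAndBefore-head-first g x y d w x≢y))
    (trans (count-injWords-last g k (remove x B) (NoDup-remove x B nd) (length-remove-suc x B onceX len))
      (cong (_* k !) (count-remove-false x g B onceX gx)))

  count-lastAndBefore-second : (g : ℕ → Bool) (x y k : ℕ) (A : List ℕ) →
    count (lastAndBefore g x y ∘ (y ∷_)) (injWords (suc k) A) ≡ 0
  count-lastAndBefore-second g x y k A =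
    trans (count-injWords-cong _ (λ _ → false) k A (λ d w → lastAndBefore-head-second g x y d w))
      (count-none _ (injWords (suc k) A) (λ _ → refl))

  -- Swapping x and y pairs the arrangements with x before y with those with y before x.
  count-injWords-last-before : (g : ℕ → Bool) (x y k : ℕ) (B : List ℕ) → NoDup B → length B ≡ suc k →
    Once x B → Once y B → x ≢ y → g x ≡ false → g y ≡ false →
    2 * count (lastAndBefore g x y) (injWords (suc k) B) ≡ count g B * k !
  count-injWords-last-before g x y zero (b ∷ []) nd len onceX onceY x≢y gx gy =
    ⊥-elim (x≢y (trans (Once-singleton b onceX) (sym (Once-singleton b onceY))))
  count-injWords-last-before g x y (suc k) B nd len onceX onceY x≢y gx gy =
    -- after adding r * k! on both sides, first entry c contributes ([c ≡ x] + [c ≢ y]) * r * k!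
    +-cancelʳ-≡ (r * f) _ _ (begin
        2 * count P (injWords (suc (suc k)) B) + r * f
      ≡⟨ cong (_+ r * f) (trans (cong (2 *_) (count-injWords-suc P (suc k) B)) (sym (sumMap-*ˡ _ 2 B))) ⟩
        sumMap byHead B + r * f
      ≡⟨ cong (sumMap byHead B +_) (trans (cong (_* f) (sym (sumMap-toℕ g B))) (sym (sumMap-*ʳ (toℕ ∘ g) f B))) ⟩
        sumMap byHead B + sumMap (λ c → toℕ (g c) * f) B
      ≡⟨ sym (sumMap-+ byHead (λ c → toℕ (g c) * f) B) ⟩
        sumMap (λ c → byHead c + toℕ (g c) * f) B
      ≡⟨ sumMap-cong B headContribution ⟩
        sumMap (λ c → (toℕ (c ≡ᵇ x) + toℕ (not (c ≡ᵇ y))) * r * f) B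
      ≡⟨ trans (sumMap-*ʳ _ f B) (cong (_* f) (sumMap-*ʳ _ r B)) ⟩
        sumMap (λ c → toℕ (c ≡ᵇ x) + toℕ (not (c ≡ᵇ y))) B * r * f
      ≡⟨ cong (λ s → s * r * f) (trans (sumMap-+ _ _ B) (cong₂ _+_ (trans (sumMap-toℕ _ B) xOnce) (trans (sumMap-toℕ _ B) notY))) ⟩
        (1 + suc k) * r * f
      ≡⟨ solve 3 (λ k r f → (con 2 :+ k) :* r :* f := r :* ((con 1 :+ k) :* f) :+ r :* f) refl k r f ⟩
        r * suc k ! + r * f
      ∎)
    where
    open ≡-Reasoning
    P = lastAndBefore g x y
    r = count g B
    f = k !
    byHead : ℕ → ℕ
    byHead c = 2 * count (P ∘ (c ∷_)) (injWords (suc k) (remove c B))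
    xOnce : count (_≡ᵇ x) B ≡ 1
    xOnce = trans (count-cong (λ c → ≡ᵇ-sym c x) B) onceX
    notY : count (not ∘ (_≡ᵇ y)) B ≡ suc k
    notY = suc-injective (trans (cong (_+ count (not ∘ (_≡ᵇ y)) B) (sym (trans (count-cong (λ c → ≡ᵇ-sym c y) B) onceY)))
             (trans (sym (length≡count+count-not (_≡ᵇ y) B)) len))
    headX : (c : ℕ) → c ≡ x → byHead c + toℕ (g c) * f ≡ 2 * r * f
    headX c refl = trans (cong₂ (λ m b → 2 * m + toℕ b * f) (count-lastAndBefore-first g c y k B nd len onceX x≢y gx) gx)
      (trans (+-identityʳ _) (sym (*-assoc 2 r f)))
    headY : (c : ℕ) → c ≡ y → byHead c + toℕ (g c) * f ≡ 0
    headY c refl = cong₂ (λ m b → 2 * m + toℕ b * f) (count-lastAndBefore-second g x c k (remove c B)) gy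
    headOther : (c : ℕ) → c ∈ B → c ≢ x → c ≢ y → byHead c + toℕ (g c) * f ≡ (r + 0) * f
    headOther c c∈B c≢x c≢y =
      begin
        byHead c + toℕ (g c) * f
      ≡⟨ cong (_+ toℕ (g c) * f) (trans (cong (2 *_) shortcut) (count-injWords-last-before g x y k (remove c B)
           (NoDup-remove c B nd) (length-remove-suc c B onceC len)
           (Once-remove c B onceX c≢x) (Once-remove c B onceY c≢y) x≢y gx gy)) ⟩
        count g (remove c B) * f + toℕ (g c) * f
      ≡⟨ sym (*-distribʳ-+ f (count g (remove c B)) (toℕ (g c))) ⟩
        (count g (remove c B) + toℕ (g c)) * f
      ≡⟨ cong (_* f) (trans (count-remove c g B onceC) (sym (+-identityʳ r))) ⟩
        (r + 0) * f
      ∎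
      where
      onceC = ∈⇒Once nd c∈B
      shortcut : count (P ∘ (c ∷_)) (injWords (suc k) (remove c B)) ≡ count P (injWords (suc k) (remove c B))
      shortcut = count-injWords-cong _ P k (remove c B) (λ d w → lastAndBefore-head-other g x y c d w c≢x c≢y)
    headContribution : (c : ℕ) → c ∈ B →
      byHead c + toℕ (g c) * f ≡ (toℕ (c ≡ᵇ x) + toℕ (not (c ≡ᵇ y))) * r * f
    headContribution c c∈B = byCases (c ≡ᵇ x) refl (c ≡ᵇ y) refl
      where
      byCases : (bx : Bool) → (c ≡ᵇ x) ≡ bx → (by : Bool) → (c ≡ᵇ y) ≡ by →
        byHead c + toℕ (g c) * f ≡ (toℕ bx + toℕ (not by)) * r * f
      byCases true cx true cy = ⊥-elim (x≢y (trans (sym (≡ᵇ-sound {c} cx)) (≡ᵇ-sound cy)))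
      byCases true cx false _ = headX c (≡ᵇ-sound cx)
      byCases false _ true cy = headY c (≡ᵇ-sound cy)
      byCases false cx false cy = headOther c c∈B (≡ᵇ-false⇒≢ {c} cx) (≡ᵇ-false⇒≢ {c} cy)

  interior : ℕ → ℕ → Bool
  interior n v = (1 <ᵇ v) ∧ (v <ᵇ n)

  interiorBy : ℕ → (ℕ → ℕ → Bool) → ℕ → ℕ → Bool
  interiorBy n cmp a v = interior n v ∧ cmp a v

  framed : ℕ → ℕ → ℕ → (ℕ → ℕ → Bool) → List ℕ → Bool
  framed n x y cmp [] = false
  framed n x y cmp (a ∷ w) = interior n a ∧ lastAndBefore (interiorBy n cmp a) x y (a ∷ w)

  framed-head-interior : (n x y : ℕ) (cmp : ℕ → ℕ → Bool) (a d : ℕ) (w : List ℕ) →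
    interior n a ≡ true → a ≢ x → a ≢ y →
    framed n x y cmp (a ∷ d ∷ w) ≡ lastAndBefore (interiorBy n cmp a) x y (d ∷ w)
  framed-head-interior n x y cmp a d w ia a≢x a≢y rewrite ia | ≢⇒≡ᵇ-false a≢x | ≢⇒≡ᵇ-false a≢y = refl

  framed-head-exterior : (n x y : ℕ) (cmp : ℕ → ℕ → Bool) (a d : ℕ) (w : List ℕ) →
    interior n a ≡ false → framed n x y cmp (a ∷ d ∷ w) ≡ false
  framed-head-exterior n x y cmp a d w ia rewrite ia = refl

  count-framed-injWords : (k x y : ℕ) (cmp : ℕ → ℕ → Bool) (A : List ℕ) → NoDup A → length A ≡ suc (suc k) →
    Once x A → Once y A → x ≢ y → interior (suc (suc k)) x ≡ false → interior (suc (suc k)) y ≡ false →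
    (∀ a → cmp a a ≡ false) →
    2 * count (framed (suc (suc k)) x y cmp) (injWords (suc (suc k)) A)
      ≡ sumMap (λ a → toℕ (interior (suc (suc k)) a) * count (interiorBy (suc (suc k)) cmp a) A) A * k !
  count-framed-injWords k x y cmp A nd len onceX onceY x≢y ix iy cmp-irrefl =
    trans (cong (2 *_) (count-injWords-suc (framed n x y cmp) (suc k) A))
    (trans (sym (sumMap-*ˡ _ 2 A))
    (trans (sumMap-cong A byHead) (sumMap-*ʳ (λ a → toℕ (interior n a) * count (interiorBy n cmp a) A) (k !) A)))
    where
    n = suc (suc k)
    byHead : (a : ℕ) → a ∈ A → 2 * count (framed n x y cmp ∘ (a ∷_)) (injWords (suc k) (remove a A))
      ≡ toℕ (interior n a) * count (interiorBy n cmp a) A * k !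
    byHead a a∈A = byInterior (interior n a) refl
      where
      onceA = ∈⇒Once nd a∈A
      byInterior : (b : Bool) → interior n a ≡ b → 2 * count (framed n x y cmp ∘ (a ∷_)) (injWords (suc k) (remove a A))
        ≡ toℕ b * count (interiorBy n cmp a) A * k !
      byInterior false ia = cong (2 *_)
        (trans (count-injWords-cong _ (λ _ → false) k (remove a A) (λ d w → framed-head-exterior n x y cmp a d w ia))
          (count-none _ (injWords (suc k) (remove a A)) (λ _ → refl)))
      byInterior true ia =
        trans (cong (2 *_) (count-injWords-cong _ (lastAndBefore (interiorBy n cmp a) x y) k (remove a A)
                              (λ d w → framed-head-interior n x y cmp a d w ia a≢x a≢y)))
        (trans (count-injWords-last-before (interiorBy n cmp a) x y k (remove a A) (NoDup-remove a A nd)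
                  (length-remove-suc a A onceA len) (Once-remove a A onceX a≢x) (Once-remove a A onceY a≢y) x≢y
                  (cong (_∧ cmp a x) ix) (cong (_∧ cmp a y) iy))
          (cong (_* k !) (trans (count-remove-false a (interiorBy n cmp a) A onceA
                                   (trans (cong (interior n a ∧_) (cmp-irrefl a)) (∧-zeroʳ _)))
                          (sym (+-identityʳ _)))))
        where
        a≢x = distinguishes (interior n) ia ix
        a≢y = distinguishes (interior n) ia iy

  range-snoc : (n : ℕ) → range 1 (suc n) ≡ range 1 n ++ [ suc n ]
  range-snoc n = trans (cong (map suc) (sym (upTo-∷ʳ n))) (map-++ suc (upTo n) [ n ])

  length-range : (n : ℕ) → length (range 1 n) ≡ n
  length-range n = trans (length-map suc (upTo n)) (length-upTo n)

  count-range-snoc : (p : ℕ → Bool) (n : ℕ) → count p (range 1 (suc n)) ≡ count p (range 1 n) + toℕ (p (suc n))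
  count-range-snoc p n = trans (cong (count p) (range-snoc n)) (trans (count-++ p (range 1 n) [ suc n ])
    (cong (count p (range 1 n) +_) (trans (count-∷ p (suc n) []) (+-identityʳ _))))

  sumMap-range-snoc : (F : ℕ → ℕ) (n : ℕ) → sumMap F (range 1 (suc n)) ≡ sumMap F (range 1 n) + F (suc n)
  sumMap-range-snoc F n =
    trans (cong (sumMap F) (range-snoc n)) (trans (sumMap-snoc (range 1 n)) (cong (sumMap F (range 1 n) +_) (+-identityʳ _)))
    where
    sumMap-snoc : (xs : List ℕ) → sumMap F (xs ++ [ suc n ]) ≡ sumMap F xs + (F (suc n) + 0)
    sumMap-snoc [] = refl
    sumMap-snoc (x ∷ xs) rewrite sumMap-snoc xs = sym (+-assoc (F x) _ _)

  count-range-between : (l h m : ℕ) → count (λ b → (l <ᵇ b) ∧ (b <ᵇ h)) (range 1 m) ≡ (m ⊓ (h ∸ 1)) ∸ l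
  count-range-between l h zero = sym (0∸n≡0 l)
  count-range-between l zero (suc m)
    rewrite count-range-snoc (λ b → (l <ᵇ b) ∧ (b <ᵇ zero)) m | count-range-between l zero m
          | ∧-zeroʳ (l <ᵇ suc m) | ⊓-zeroʳ m = +-identityʳ _
  count-range-between l (suc h) (suc m)
    rewrite count-range-snoc (λ b → (l <ᵇ b) ∧ (b <ᵇ suc h)) m | count-range-between l (suc h) m
    with <-cmp m h
  ... | tri< m<h _ _ rewrite m≤n⇒m⊓n≡m (<⇒≤ m<h) | m≤n⇒m⊓n≡m m<h | <ᵇ-true m<h | ∧-identityʳ (l <ᵇ suc m) = newPoint
    where
    newPoint : m ∸ l + toℕ (l <ᵇ suc m) ≡ suc m ∸ l
    newPoint with l ≤? m
    ... | yes l≤m rewrite <ᵇ-true (s≤s l≤m) = trans (+-comm _ 1) (sym (+-∸-assoc 1 l≤m))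
    ... | no l≰m rewrite <ᵇ-false {l} {suc m} (≰⇒> l≰m) | m≤n⇒m∸n≡0 (<⇒≤ (≰⇒> l≰m)) | m≤n⇒m∸n≡0 (≰⇒> l≰m) = refl
  ... | tri≈ _ refl _ rewrite m≤n⇒m⊓n≡m (≤-refl {m}) | m≥n⇒m⊓n≡n (n≤1+n m) | <ᵇ-irrefl m | ∧-zeroʳ (l <ᵇ suc m) =
    +-identityʳ _
  ... | tri> _ _ h<m
    rewrite m≥n⇒m⊓n≡n (<⇒≤ h<m) | m≥n⇒m⊓n≡n (≤-trans (<⇒≤ h<m) (n≤1+n m)) | <ᵇ-false {m} {h} (<⇒≤ h<m)
          | ∧-zeroʳ (l <ᵇ suc m) = +-identityʳ _

  count-≡ᵇ-range : (z n : ℕ) → count (suc z ≡ᵇ_) (range 1 n) ≡ (n ⊓ suc z) ∸ z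
  count-≡ᵇ-range z n = trans (count-cong (between z) (range 1 n)) (count-range-between z (suc (suc z)) n)
    where
    between : (z b : ℕ) → (suc z ≡ᵇ b) ≡ ((z <ᵇ b) ∧ (b <ᵇ suc (suc z)))
    between z zero = refl
    between zero (suc zero) = refl
    between zero (suc (suc b)) = refl
    between (suc z) (suc b) = between z b

  Once-range : (z n : ℕ) → 1 ≤ z → z ≤ n → Once z (range 1 n)
  Once-range (suc z) n _ 1+z≤n rewrite count-≡ᵇ-range z n | m≥n⇒m⊓n≡n 1+z≤n =
    trans (+-∸-assoc 1 (≤-refl {z})) (cong suc (n∸n≡0 z))

  NoDup-range : (n : ℕ) → NoDup (range 1 n)
  NoDup-range n zero =
    ≤-trans (≤-reflexive (trans (count-map (zero ≡ᵇ_) suc (upTo n)) (count-none _ (upTo n) (λ _ → refl)))) z≤n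
  NoDup-range n (suc z) rewrite count-≡ᵇ-range z n =
    ≤-trans (∸-monoˡ-≤ z (m⊓n≤n n (suc z))) (≤-reflexive (trans (+-∸-assoc 1 (≤-refl {z})) (cong suc (n∸n≡0 z))))

  count-interior : (n : ℕ) → count (interior n) (range 1 n) ≡ n ∸ 2
  count-interior n =
    trans (count-range-between 1 n n) (trans (cong (_∸ 1) (m≥n⇒m⊓n≡n (m∸n≤m n 1))) (∸-+-assoc n 1 1))

  C2-suc : (m : ℕ) → suc m C 2 ≡ m + m C 2
  C2-suc m = trans (sym (nCk+nC[k+1]≡[n+1]C[k+1] m 1)) (cong (_+ m C 2) (nC1≡n m))

  C2-∸2-suc : (n : ℕ) → (n ∸ 2) C 2 + (n ∸ 2) ≡ (suc n ∸ 2) C 2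
  C2-∸2-suc zero = refl
  C2-∸2-suc (suc zero) = refl
  C2-∸2-suc (suc (suc n)) = trans (+-comm _ n) (sym (C2-suc n))

  2*C2 : (m : ℕ) → 2 * (suc (suc m) C 2) ≡ suc (suc m) * suc m
  2*C2 zero = refl
  2*C2 (suc m) rewrite C2-suc (suc (suc m)) | *-distribˡ-+ 2 (suc (suc m)) (suc (suc m) C 2) | 2*C2 m =
    solve 1 (λ m → con 2 :* (con 2 :+ m) :+ (con 2 :+ m) :* (con 1 :+ m) := (con 3 :+ m) :* (con 2 :+ m)) refl m

  above : ℕ → ℕ → ℕ
  above n a = toℕ (interior n a) * ((n ∸ 1) ∸ a)

  below : ℕ → ℕ → ℕ
  below n a = toℕ (interior n a) * ((a ∸ 1) ∸ 1)

  above-suc : (n a : ℕ) → above (suc n) a ≡ above n a + toℕ (interior n a)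
  above-suc n a with 1 <ᵇ a
  ... | false = refl
  ... | true with <-cmp a n
  ...   | tri< a<n _ _ rewrite <ᵇ-true {a} {suc n} (≤-trans a<n (n≤1+n n)) | <ᵇ-true a<n =
          trans (+-identityʳ _) (trans (lemma n a a<n) (trans (cong suc (sym (+-identityʳ _))) (+-comm 1 _)))
    where
    lemma : (n a : ℕ) → a < n → n ∸ a ≡ suc ((n ∸ 1) ∸ a)
    lemma (suc n) zero _ = refl
    lemma (suc n) (suc a) (s≤s a<n) = trans (lemma n a a<n) (cong suc (∸-+-assoc n 1 a))
  ...   | tri≈ _ refl _ rewrite <ᵇ-true {a} {suc a} ≤-refl | <ᵇ-irrefl a | n∸n≡0 a = refl
  ...   | tri> _ _ n<a rewrite <ᵇ-false {a} {suc n} n<a | <ᵇ-false {a} {n} (<⇒≤ n<a) = refl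

  below-suc : (n a : ℕ) → below (suc n) a ≡ below n a + toℕ (n ≡ᵇ a) * (n ∸ 2)
  below-suc n a with <-cmp a n
  ... | tri< a<n _ _
    rewrite <ᵇ-true {a} {suc n} (≤-trans a<n (n≤1+n n)) | <ᵇ-true a<n | ≢⇒≡ᵇ-false {n} {a} (λ e → <-irrefl (sym e) a<n) =
    sym (+-identityʳ _)
  ... | tri≈ _ refl _
    rewrite <ᵇ-true {a} {suc a} ≤-refl | <ᵇ-irrefl a | ≡ᵇ-refl a | ∧-zeroʳ (1 <ᵇ a) | ∧-identityʳ (1 <ᵇ a) = lemma a
    where
    lemma : (a : ℕ) → toℕ (1 <ᵇ a) * ((a ∸ 1) ∸ 1) ≡ 0 + (a ∸ 2 + 0)
    lemma zero = refl
    lemma (suc zero) = refl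
    lemma (suc (suc a)) = trans (+-identityʳ _) (sym (+-identityʳ _))
  ... | tri> _ _ n<a
    rewrite <ᵇ-false {a} {suc n} n<a | <ᵇ-false {a} {n} (<⇒≤ n<a) | ≢⇒≡ᵇ-false {n} {a} (λ e → <-irrefl e n<a)
          | ∧-zeroʳ (1 <ᵇ a) = refl

  sumMap-above : (n : ℕ) → sumMap (above n) (range 1 n) ≡ (n ∸ 2) C 2
  sumMap-above zero = refl
  sumMap-above (suc n) =
    begin
      sumMap (above (suc n)) (range 1 (suc n))
    ≡⟨ trans (sumMap-range-snoc (above (suc n)) n) (cong (sumMap (above (suc n)) (range 1 n) +_) lastVanishes) ⟩
      sumMap (above (suc n)) (range 1 n) + 0
    ≡⟨ trans (+-identityʳ _) (sumMap-cong (range 1 n) (λ a _ → above-suc n a)) ⟩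
      sumMap (λ a → above n a + toℕ (interior n a)) (range 1 n)
    ≡⟨ sumMap-+ (above n) (toℕ ∘ interior n) (range 1 n) ⟩
      sumMap (above n) (range 1 n) + sumMap (toℕ ∘ interior n) (range 1 n)
    ≡⟨ cong₂ _+_ (sumMap-above n) (trans (sumMap-toℕ (interior n) (range 1 n)) (count-interior n)) ⟩
      (n ∸ 2) C 2 + (n ∸ 2)
    ≡⟨ C2-∸2-suc n ⟩
      (suc n ∸ 2) C 2
    ∎
    where
    open ≡-Reasoning
    lastVanishes : above (suc n) (suc n) ≡ 0
    lastVanishes rewrite <ᵇ-irrefl n | ∧-zeroʳ (1 <ᵇ suc n) = refl

  sumMap-below : (n : ℕ) → sumMap (below n) (range 1 n) ≡ (n ∸ 2) C 2
  sumMap-below zero = refl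
  sumMap-below (suc n) =
    begin
      sumMap (below (suc n)) (range 1 (suc n))
    ≡⟨ trans (sumMap-range-snoc (below (suc n)) n) (cong (sumMap (below (suc n)) (range 1 n) +_) lastVanishes) ⟩
      sumMap (below (suc n)) (range 1 n) + 0
    ≡⟨ trans (+-identityʳ _) (sumMap-cong (range 1 n) (λ a _ → below-suc n a)) ⟩
      sumMap (λ a → below n a + toℕ (n ≡ᵇ a) * (n ∸ 2)) (range 1 n)
    ≡⟨ sumMap-+ (below n) (λ a → toℕ (n ≡ᵇ a) * (n ∸ 2)) (range 1 n) ⟩
      sumMap (below n) (range 1 n) + sumMap (λ a → toℕ (n ≡ᵇ a) * (n ∸ 2)) (range 1 n)
    ≡⟨ cong₂ _+_ (sumMap-below n) (trans (sumMap-*ʳ (toℕ ∘ (n ≡ᵇ_)) (n ∸ 2) (range 1 n))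
                                        (cong (_* (n ∸ 2)) (trans (sumMap-toℕ (n ≡ᵇ_) (range 1 n)) (nOnce n)))) ⟩
      (n ∸ 2) C 2 + toℕ (1 ≤ᵇ n) * (n ∸ 2)
    ≡⟨ cong ((n ∸ 2) C 2 +_) (lowCases n) ⟩
      (n ∸ 2) C 2 + (n ∸ 2)
    ≡⟨ C2-∸2-suc n ⟩
      (suc n ∸ 2) C 2
    ∎
    where
    open ≡-Reasoning
    lastVanishes : below (suc n) (suc n) ≡ 0
    lastVanishes rewrite <ᵇ-irrefl n | ∧-zeroʳ (1 <ᵇ suc n) = refl
    nOnce : (n : ℕ) → count (n ≡ᵇ_) (range 1 n) ≡ toℕ (1 ≤ᵇ n)
    nOnce zero = refl
    nOnce (suc n) = Once-range (suc n) (suc n) (s≤s z≤n) ≤-refl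
    lowCases : (n : ℕ) → toℕ (1 ≤ᵇ n) * (n ∸ 2) ≡ n ∸ 2
    lowCases zero = refl
    lowCases (suc n) = +-identityʳ _

  sumMap-interior-above : (n : ℕ) →
    sumMap (λ a → toℕ (interior n a) * count (interiorBy n _<ᵇ_ a) (range 1 n)) (range 1 n) ≡ (n ∸ 2) C 2
  sumMap-interior-above n = trans (sumMap-cong (range 1 n) (λ a _ → count-above a (interior n a) refl)) (sumMap-above n)
    where
    count-above : (a : ℕ) (b : Bool) → interior n a ≡ b →
      toℕ b * count (interiorBy n _<ᵇ_ a) (range 1 n) ≡ toℕ b * ((n ∸ 1) ∸ a)
    count-above a false _ = refl
    count-above a true ia =
      cong (1 *_) (trans (count-cong aboveA (range 1 n)) (trans (count-range-between a n n) (cong (_∸ a) (m≥n⇒m⊓n≡n (m∸n≤m n 1)))))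
      where
      aboveA : (v : ℕ) → interiorBy n _<ᵇ_ a v ≡ ((a <ᵇ v) ∧ (v <ᵇ n))
      aboveA v with a <ᵇ v in a<ᵇv
      ... | false = ∧-zeroʳ _
      ... | true rewrite <ᵇ-true {1} {v} (<-trans (<ᵇ-sound (∧-conicalˡ _ _ ia)) (<ᵇ-sound a<ᵇv)) = ∧-identityʳ _

  sumMap-interior-below : (n : ℕ) →
    sumMap (λ a → toℕ (interior n a) * count (interiorBy n (λ a v → v <ᵇ a) a) (range 1 n)) (range 1 n) ≡ (n ∸ 2) C 2
  sumMap-interior-below n = trans (sumMap-cong (range 1 n) (λ a _ → count-below a (interior n a) refl)) (sumMap-below n)
    where
    count-below : (a : ℕ) (b : Bool) → interior n a ≡ b →
      toℕ b * count (interiorBy n (λ a v → v <ᵇ a) a) (range 1 n) ≡ toℕ b * ((a ∸ 1) ∸ 1)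
    count-below a false _ = refl
    count-below a true ia =
      cong (1 *_) (trans (count-cong belowA (range 1 n))
        (trans (count-range-between 1 a n) (cong (_∸ 1) (m≥n⇒m⊓n≡n (≤-trans (m∸n≤m a 1) (<⇒≤ a<n))))))
      where
      a<n : a < n
      a<n = <ᵇ-sound (∧-conicalʳ _ _ ia)
      belowA : (v : ℕ) → interiorBy n (λ a v → v <ᵇ a) a v ≡ ((1 <ᵇ v) ∧ (v <ᵇ a))
      belowA v with v <ᵇ a in v<ᵇa
      ... | false = trans (∧-zeroʳ _) (sym (∧-zeroʳ _))
      ... | true rewrite <ᵇ-true {v} {n} (<-trans (<ᵇ-sound v<ᵇa) a<n) = ∧-identityʳ _

  count-framed : (m x y : ℕ) (cmp : ℕ → ℕ → Bool) →
    let n = suc (suc (suc (suc m))) in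
    Once x (range 1 n) → Once y (range 1 n) → x ≢ y → interior n x ≡ false → interior n y ≡ false →
    (∀ a → cmp a a ≡ false) →
    sumMap (λ a → toℕ (interior n a) * count (interiorBy n cmp a) (range 1 n)) (range 1 n) ≡ (n ∸ 2) C 2 →
    count (framed n x y cmp) (S n) ≡ ((n ∸ 2) C 2) ^ 2 * (n ∸ 4) !
  count-framed m x y cmp onceX onceY x≢y ix iy cmp-irrefl pairs =
    *-cancelˡ-≡ _ _ 2 (begin
        2 * count (framed n x y cmp) (injWords n (range 1 n))
      ≡⟨ count-framed-injWords (suc (suc m)) x y cmp (range 1 n) (NoDup-range n) (length-range n)
           onceX onceY x≢y ix iy cmp-irrefl ⟩
        sumMap (λ a → toℕ (interior n a) * count (interiorBy n cmp a) (range 1 n)) (range 1 n) * (suc (suc m)) !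
      ≡⟨ cong (_* (suc (suc m)) !) pairs ⟩
        Cn * (suc (suc m) * (suc m * m !))
      ≡⟨ cong (Cn *_) (trans (sym (*-assoc (suc (suc m)) (suc m) (m !))) (cong (_* m !) (sym (2*C2 m)))) ⟩
        Cn * (2 * Cn * m !)
      ≡⟨ solve 2 (λ c f → c :* (con 2 :* c :* f) := con 2 :* (c :* (c :* con 1) :* f)) refl Cn (m !) ⟩
        2 * (Cn ^ 2 * m !)
      ∎)
    where
    open ≡-Reasoning
    n = suc (suc (suc (suc m)))
    Cn = suc (suc m) C 2

module Containment where

  open Counting
  open import Data.Bool using (Bool; true; false; _∧_; not; if_then_else_)
  open import Data.Bool.Properties using (∧-zeroʳ; ∧-conicalˡ; ∧-conicalʳ; T-≡)
  open import Data.Bool.ListAction using (all; any)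
  open import Data.Empty using (⊥; ⊥-elim)
  open import Data.List using (List; []; _∷_; _++_; [_]; length; map; upTo; concatMap; filterᵇ)
  open import Data.List.Membership.Propositional using (_∈_; find; lose)
  open import Data.List.Membership.Propositional.Properties
    using (∈-filter⁻; ∈-filter⁺; ∈-concatMap⁻; ∈-concatMap⁺; ∈-map⁻; ∈-map⁺; ∈-upTo⁻; ∈-upTo⁺; ∈-++⁺ˡ; ∈-++⁺ʳ)
  open import Data.List.Relation.Unary.All using (All; []; _∷_)
  import Data.List.Relation.Unary.All as All
  open import Data.List.Relation.Unary.Any using (here; there)
  open import Data.Nat using (ℕ; zero; suc; _+_; _*_; _∸_; _≡ᵇ_; _<ᵇ_; _≤_; _<_; z≤n; s≤s; _!; _^_; _≟_)
  open import Data.Nat.Properties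
  open import Data.Nat.Combinatorics using (_C_)
  open import Data.Product using (_×_; _,_; Σ; proj₁; proj₂)
  open import Data.Sum using (_⊎_; inj₁; inj₂)
  open import Function using (_∘_)
  open import Function.Bundles using (Equivalence)
  open import Relation.Binary.Definitions using (tri<; tri≈; tri>)
  open import Relation.Binary.PropositionalEquality hiding ([_])
  open import Relation.Nullary using (yes; no)

  -- The local definitions of isOccurrence, made global: isOccurrence n τ (π , R) is
  -- unfolds to orderIso τ π is n ∧ all (emptyBox n τ is) R.
  I : ℕ → List ℕ → ℕ → ℕ
  I n is x = nth0 (0 ∷ is ++ [ suc n ]) x

  V : ℕ → List ℕ → List ℕ → ℕ → ℕ
  V n τ is y = nth0 (0 ∷ sort (map (at τ) is) ++ [ suc n ]) y

  orderIso : List ℕ → List ℕ → List ℕ → ℕ → Bool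
  orderIso τ π is n = all (λ a → all (λ b → (at τ (I n is a) <ᵇ at τ (I n is b)) == (at π a <ᵇ at π b))
                         (range 1 (length π))) (range 1 (length π))

  inBox : ℕ → List ℕ → List ℕ → ℕ × ℕ → ℕ → Bool
  inBox n τ is (x , y) m = (I n is x <ᵇ m) ∧ (m <ᵇ I n is (suc x)) ∧ (V n τ is y <ᵇ at τ m) ∧ (at τ m <ᵇ V n τ is (suc y))

  emptyBox : ℕ → List ℕ → List ℕ → ℕ × ℕ → Bool
  emptyBox n τ is b = not (any (inBox n τ is b) (range 1 n))

  inBox-intro : (n : ℕ) (τ is : List ℕ) (x y m : ℕ) →
    I n is x < m → m < I n is (suc x) → V n τ is y < at τ m → at τ m < V n τ is (suc y) →
    inBox n τ is (x , y) m ≡ true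
  inBox-intro n τ is x y m l r b t rewrite <ᵇ-true l | <ᵇ-true r | <ᵇ-true b | <ᵇ-true t = refl

  Bool-iff : {a b : Bool} → (a ≡ true → b ≡ true) → (b ≡ true → a ≡ true) → a ≡ b
  Bool-iff {true} {true} _ _ = refl
  Bool-iff {false} {false} _ _ = refl
  Bool-iff {true} {false} f _ with f refl
  ... | ()
  Bool-iff {false} {true} _ g with g refl
  ... | ()

  ==-true : {b : Bool} → (b == true) ≡ true → b ≡ true
  ==-true {true} _ = refl

  not-true : {b : Bool} → not b ≡ true → b ≡ false
  not-true {false} _ = refl

  module _ {X : Set} where

    ∈-filterᵇ⁻ : {p : X → Bool} {x : X} (xs : List X) → x ∈ filterᵇ p xs → x ∈ xs × p x ≡ true
    ∈-filterᵇ⁻ {p} xs x∈ with ∈-filter⁻ (Data.Bool.T? ∘ p) {xs = xs} x∈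
    ... | x∈xs , px = x∈xs , Equivalence.to T-≡ px

    ∈-filterᵇ⁺ : {p : X → Bool} {x : X} (xs : List X) → x ∈ xs → p x ≡ true → x ∈ filterᵇ p xs
    ∈-filterᵇ⁺ {p} xs x∈xs px = ∈-filter⁺ (Data.Bool.T? ∘ p) x∈xs (Equivalence.from T-≡ px)

    all-∈ : (f : X → Bool) (xs : List X) {x : X} → all f xs ≡ true → x ∈ xs → f x ≡ true
    all-∈ f (y ∷ xs) e (here refl) = ∧-conicalˡ _ _ e
    all-∈ f (y ∷ xs) e (there x∈) = all-∈ f xs (∧-conicalʳ (f y) _ e) x∈

    any-false : (f : X → Bool) (xs : List X) → (∀ x → f x ≡ false) → any f xs ≡ false
    any-false f [] _ = refl
    any-false f (x ∷ xs) e rewrite e x = any-false f xs e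

    any-false⇒false : (f : X → Bool) (xs : List X) {x : X} → any f xs ≡ false → x ∈ xs → f x ≡ false
    any-false⇒false f (y ∷ xs) e (here refl) with f y
    ... | false = refl
    any-false⇒false f (y ∷ xs) e (there x∈) with f y
    ... | false = any-false⇒false f xs e x∈

    any⇒∈ : (f : X → Bool) (xs : List X) → any f xs ≡ true → Σ X (λ x → x ∈ xs × f x ≡ true)
    any⇒∈ f (x ∷ xs) e with f x in fx
    ... | true = x , here refl , fx
    ... | false with any⇒∈ f xs e
    ...   | y , y∈ , fy = y , there y∈ , fy

    ∈⇒any : (f : X → Bool) (xs : List X) {x : X} → x ∈ xs → f x ≡ true → any f xs ≡ true
    ∈⇒any f (y ∷ xs) (here refl) e rewrite e = refl
    ∈⇒any f (y ∷ xs) (there x∈) e with f y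
    ... | true = refl
    ... | false = ∈⇒any f xs x∈ e

  ∈-words⁻ : (k : ℕ) (A : List ℕ) (v : List ℕ) → v ∈ words k A → length v ≡ k × All (_∈ A) v
  ∈-words⁻ zero A .[] (here refl) = refl , []
  ∈-words⁻ (suc k) A v v∈ with find (∈-concatMap⁻ (λ a → map (a ∷_) (words k A)) {xs = A} v∈)
  ... | a , a∈A , v∈′ with ∈-map⁻ (a ∷_) v∈′
  ... | w , w∈ , refl with ∈-words⁻ k A w w∈
  ... | len , all∈ = cong suc len , (a∈A ∷ all∈)

  ∈-words⁺ : (k : ℕ) (A : List ℕ) (v : List ℕ) → length v ≡ k → All (_∈ A) v → v ∈ words k A
  ∈-words⁺ zero A [] refl [] = here refl
  ∈-words⁺ (suc k) A (a ∷ w) len (a∈ ∷ all∈) =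
    ∈-concatMap⁺ (λ a → map (a ∷_) (words k A)) (lose a∈ (∈-map⁺ (a ∷_) (∈-words⁺ k A w (suc-injective len) all∈)))

  ∈-injWords : (k : ℕ) (A : List ℕ) (τ : List ℕ) (v : ℕ) → τ ∈ injWords k A → length A ≡ k → NoDup A → Once v A → v ∈ τ
  ∈-injWords zero [] τ v τ∈ len nd ()
  ∈-injWords (suc k) A τ v τ∈ len nd onceV rewrite injWords-suc k A
    with find (∈-concatMap⁻ (λ c → map (c ∷_) (injWords k (remove c A))) {xs = A} τ∈)
  ... | c , c∈A , τ∈′ with ∈-map⁻ (c ∷_) τ∈′
  ... | τ′ , τ′∈ , refl with c ≡ᵇ v in e
  ... | true = here (sym (≡ᵇ-sound e))
  ... | false = there (∈-injWords k (remove c A) τ′ v τ′∈ (length-remove-suc c A (∈⇒Once nd c∈A) len)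
                   (NoDup-remove c A nd) (Once-remove c A onceV (≡ᵇ-false⇒≢ {c} e)))

  ∈-range⁻ : {n v : ℕ} → v ∈ range 1 n → 1 ≤ v × v ≤ n
  ∈-range⁻ {n} v∈ with ∈-map⁻ suc {xs = upTo n} v∈
  ... | i , i∈ , refl = s≤s z≤n , ∈-upTo⁻ i∈

  ∈-range⁺ : {n v : ℕ} → 1 ≤ v → v ≤ n → v ∈ range 1 n
  ∈-range⁺ {n} {suc v} _ v≤n = ∈-map⁺ suc (∈-upTo⁺ v≤n)

  at-∈ : (τ : List ℕ) (p : ℕ) → 1 ≤ p → p ≤ length τ → at τ p ∈ τ
  at-∈ (x ∷ τ) (suc zero) _ _ = here refl
  at-∈ (x ∷ τ) (suc (suc p)) _ (s≤s p≤) = there (at-∈ τ (suc p) (s≤s z≤n) p≤)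

  ∈⇒at : (τ : List ℕ) (v : ℕ) → v ∈ τ → Σ ℕ (λ p → (1 ≤ p × p ≤ length τ) × at τ p ≡ v)
  ∈⇒at (x ∷ τ) v (here refl) = 1 , (s≤s z≤n , s≤s z≤n) , refl
  ∈⇒at (x ∷ τ) v (there v∈) with ∈⇒at τ v v∈
  ... | suc p , (_ , p≤) , e = suc (suc p) , (s≤s z≤n , s≤s p≤) , e

  distinct-head-∉ : (c : ℕ) (w : List ℕ) → distinct (c ∷ w) ≡ true → (p : ℕ) → 1 ≤ p → p ≤ length w → c ≢ at w p
  distinct-head-∉ c w d p 1≤p p≤ c≡
    with all-∈ (λ z → not (c ≡ᵇ z)) w (∧-conicalˡ _ _ (trans (sym (distinct-∷ c w)) d)) (at-∈ w p 1≤p p≤)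
  ... | notSelf rewrite sym c≡ | ≡ᵇ-refl c with notSelf
  ...   | ()

  distinct-tail : (c : ℕ) (w : List ℕ) → distinct (c ∷ w) ≡ true → distinct w ≡ true
  distinct-tail c w d = ∧-conicalʳ (all (λ z → not (c ≡ᵇ z)) w) _ (trans (sym (distinct-∷ c w)) d)

  at-injective : (τ : List ℕ) → distinct τ ≡ true → (p q : ℕ) → 1 ≤ p → p ≤ length τ → 1 ≤ q → q ≤ length τ →
    at τ p ≡ at τ q → p ≡ q
  at-injective (c ∷ w) d (suc zero) (suc zero) _ _ _ _ _ = refl
  at-injective (c ∷ w) d (suc zero) (suc (suc q)) _ _ _ (s≤s q≤) e =
    ⊥-elim (distinct-head-∉ c w d (suc q) (s≤s z≤n) q≤ e)
  at-injective (c ∷ w) d (suc (suc p)) (suc zero) _ (s≤s p≤) _ _ e =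
    ⊥-elim (distinct-head-∉ c w d (suc p) (s≤s z≤n) p≤ (sym e))
  at-injective (c ∷ w) d (suc (suc p)) (suc (suc q)) _ (s≤s p≤) _ (s≤s q≤) e =
    cong suc (at-injective w (distinct-tail c w d) (suc p) (suc q) (s≤s z≤n) p≤ (s≤s z≤n) q≤ e)

  position-at : (τ : List ℕ) → distinct τ ≡ true → (p : ℕ) → 1 ≤ p → p ≤ length τ → position (at τ p) τ ≡ p ∸ 1
  position-at (c ∷ w) d (suc zero) _ _ rewrite ≡ᵇ-refl c = refl
  position-at (c ∷ w) d (suc (suc p)) _ (s≤s p≤)
    rewrite ≢⇒≡ᵇ-false (distinct-head-∉ c w d (suc p) (s≤s z≤n) p≤) =
    cong suc (position-at w (distinct-tail c w d) (suc p) (s≤s z≤n) p≤)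

  last-at : (c : ℕ) (w : List ℕ) → last (c ∷ w) ≡ at (c ∷ w) (length (c ∷ w))
  last-at c [] = refl
  last-at c (d ∷ w) = last-at d w

  record IsPerm (n : ℕ) (τ : List ℕ) : Set where
    field
      len : length τ ≡ n
      dist : distinct τ ≡ true
      rng : ∀ p → 1 ≤ p → p ≤ n → 1 ≤ at τ p × at τ p ≤ n
      surj : ∀ v → 1 ≤ v → v ≤ n → Σ ℕ (λ p → (1 ≤ p × p ≤ n) × at τ p ≡ v)

    position-at-perm : (p : ℕ) → 1 ≤ p → p ≤ n → position (at τ p) τ ≡ p ∸ 1
    position-at-perm p 1≤p p≤n = position-at τ dist p 1≤p (subst (p ≤_) (sym len) p≤n)

    at-injective-perm : (p q : ℕ) → 1 ≤ p → p ≤ n → 1 ≤ q → q ≤ n → at τ p ≡ at τ q → p ≡ q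
    at-injective-perm p q 1≤p p≤n 1≤q q≤n =
      at-injective τ dist p q 1≤p (subst (p ≤_) (sym len) p≤n) 1≤q (subst (q ≤_) (sym len) q≤n)

  S⇒IsPerm : (n : ℕ) (τ : List ℕ) → τ ∈ S n → IsPerm n τ
  S⇒IsPerm n τ τ∈ = record { len = len ; dist = proj₂ filtered ; rng = rng ; surj = surj }
    where
    filtered = ∈-filterᵇ⁻ {p = distinct} (words n (range 1 n)) τ∈
    word = ∈-words⁻ n (range 1 n) τ (proj₁ filtered)
    len = proj₁ word
    rng : ∀ p → 1 ≤ p → p ≤ n → 1 ≤ at τ p × at τ p ≤ n
    rng p 1≤p p≤n = ∈-range⁻ (All.lookup (proj₂ word) (at-∈ τ p 1≤p (subst (p ≤_) (sym len) p≤n)))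
    surj : ∀ v → 1 ≤ v → v ≤ n → Σ ℕ (λ p → (1 ≤ p × p ≤ n) × at τ p ≡ v)
    surj v 1≤v v≤n with ∈⇒at τ v (∈-injWords n (range 1 n) τ v τ∈ (length-range n) (NoDup-range n) (Once-range v n 1≤v v≤n))
    ... | p , (1≤p , p≤) , e = p , (1≤p , subst (p ≤_) len p≤) , e

  ∈-boundary4-column : {x : ℕ} (y : ℕ) → x ∈ 0 ∷ 4 ∷ [] → y ≤ 4 → (x , y) ∈ boundary4
  ∈-boundary4-column {x} y x∈ y≤4 =
    ∈-++⁺ˡ (∈-concatMap⁺ (λ x → map (x ,_) (range 0 4)) (lose x∈ (∈-map⁺ (x ,_) (∈-map⁺ (0 +_) (∈-upTo⁺ (s≤s y≤4))))))

  ∈-boundary4-row : (x : ℕ) {y : ℕ} → x ≤ 4 → y ∈ 0 ∷ 4 ∷ [] → (x , y) ∈ boundary4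
  ∈-boundary4-row x x≤4 y∈ =
    ∈-++⁺ʳ (concatMap (λ x → map (x ,_) (range 0 4)) (0 ∷ 4 ∷ []))
      (∈-concatMap⁺ (λ x → map (x ,_) (0 ∷ 4 ∷ [])) (lose (∈-map⁺ (0 +_) (∈-upTo⁺ (s≤s x≤4))) (∈-map⁺ (x ,_) y∈)))

  all-boundary4 : (f : ℕ × ℕ → Bool) → (∀ y → f (0 , y) ≡ true) → (∀ y → f (4 , y) ≡ true) →
    (∀ x → f (x , 0) ≡ true) → (∀ x → f (x , 4) ≡ true) → all f boundary4 ≡ true
  all-boundary4 f c0 c4 r0 r4
    rewrite c0 0 | c0 1 | c0 2 | c0 3 | c0 4 | c4 0 | c4 1 | c4 2 | c4 3 | c4 4
          | r0 1 | r0 2 | r0 3 | r4 1 | r4 2 | r4 3 = refl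

  no-ℕ-between : (n m : ℕ) → ((n <ᵇ m) ∧ (m <ᵇ suc n)) ≡ false
  no-ℕ-between zero zero = refl
  no-ℕ-between zero (suc m) = refl
  no-ℕ-between (suc n) zero = refl
  no-ℕ-between (suc n) (suc m) = no-ℕ-between n m

  no-ℕ-between-∧ : (n m : ℕ) (b : Bool) → ((n <ᵇ m) ∧ (m <ᵇ suc n) ∧ b) ≡ false
  no-ℕ-between-∧ zero zero b = refl
  no-ℕ-between-∧ zero (suc m) b = refl
  no-ℕ-between-∧ (suc n) zero b = refl
  no-ℕ-between-∧ (suc n) (suc m) b = no-ℕ-between-∧ n m b

  V-sorted : (n : ℕ) (τ is : List ℕ) {v₁ v₂ v₃ v₄ : ℕ} → sort (map (at τ) is) ≡ v₁ ∷ v₂ ∷ v₃ ∷ v₄ ∷ [] →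
    (k : ℕ) → V n τ is k ≡ nth0 (0 ∷ v₁ ∷ v₂ ∷ v₃ ∷ v₄ ∷ suc n ∷ []) k
  V-sorted n τ is sorted k = cong (λ l → nth0 (0 ∷ l ++ [ suc n ]) k) sorted

  -- With first and last position and least and greatest value all used, the shaded boxes are
  -- empty for want of room: they are open intervals between consecutive integers.
  boundary4-empty : (n : ℕ) (τ : List ℕ) (p q b c : ℕ) →
    sort (map (at τ) (1 ∷ p ∷ q ∷ n ∷ [])) ≡ 1 ∷ b ∷ c ∷ n ∷ [] →
    all (emptyBox n τ (1 ∷ p ∷ q ∷ n ∷ [])) boundary4 ≡ true
  boundary4-empty n τ p q b c sorted = all-boundary4 (emptyBox n τ is)
    (λ y → cong not (any-false (inBox n τ is (0 , y)) (range 1 n) (λ m → no-ℕ-between-∧ 0 m _)))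
    (λ y → cong not (any-false (inBox n τ is (4 , y)) (range 1 n) (λ m → no-ℕ-between-∧ n m _)))
    (λ x → cong not (any-false (inBox n τ is (x , 0)) (range 1 n) (λ m → bottomRow x m)))
    (λ x → cong not (any-false (inBox n τ is (x , 4)) (range 1 n) (λ m → topRow x m)))
    where
    is : List ℕ
    is = 1 ∷ p ∷ q ∷ n ∷ []
    VE = V-sorted n τ is sorted
    lastConjunct : (A B C : Bool) → C ≡ false → (A ∧ B ∧ C) ≡ false
    lastConjunct A B C e rewrite e | ∧-zeroʳ B | ∧-zeroʳ A = refl
    bottomRow : (x m : ℕ) → inBox n τ is (x , 0) m ≡ false
    bottomRow x m = trans (cong (λ v → (I n is x <ᵇ m) ∧ (m <ᵇ I n is (suc x)) ∧ (0 <ᵇ at τ m) ∧ (at τ m <ᵇ v)) (VE 1))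
      (lastConjunct (I n is x <ᵇ m) (m <ᵇ I n is (suc x)) _ (no-ℕ-between 0 (at τ m)))
    topRow : (x m : ℕ) → inBox n τ is (x , 4) m ≡ false
    topRow x m =
      trans (cong₂ (λ v v′ → (I n is x <ᵇ m) ∧ (m <ᵇ I n is (suc x)) ∧ (v <ᵇ at τ m) ∧ (at τ m <ᵇ v′)) (VE 4) (VE 5))
      (lastConjunct (I n is x <ᵇ m) (m <ᵇ I n is (suc x)) _ (no-ℕ-between n (at τ m)))

  Among4 : ℕ → ℕ → ℕ → ℕ → ℕ → Set
  Among4 w a b c d = (w ≡ a) ⊎ (w ≡ b) ⊎ (w ≡ c) ⊎ (w ≡ d)

  locate : (c : ℕ → ℕ) (w : ℕ) → c 0 < w → w < c 5 →
    w ≢ c 1 → w ≢ c 2 → w ≢ c 3 → w ≢ c 4 →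
    Σ ℕ (λ y → y ≤ 4 × c y < w × w < c (suc y))
  locate c w l0 l5 n1 n2 n3 n4 with <-cmp w (c 1)
  ... | tri< a _ _ = 0 , z≤n , l0 , a
  ... | tri≈ _ e _ = ⊥-elim (n1 e)
  ... | tri> _ _ g1 with <-cmp w (c 2)
  ...   | tri< a _ _ = 1 , s≤s z≤n , g1 , a
  ...   | tri≈ _ e _ = ⊥-elim (n2 e)
  ...   | tri> _ _ g2 with <-cmp w (c 3)
  ...     | tri< a _ _ = 2 , s≤s (s≤s z≤n) , g2 , a
  ...     | tri≈ _ e _ = ⊥-elim (n3 e)
  ...     | tri> _ _ g3 with <-cmp w (c 4)
  ...       | tri< a _ _ = 3 , s≤s (s≤s (s≤s z≤n)) , g3 , a
  ...       | tri≈ _ e _ = ⊥-elim (n4 e)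
  ...       | tri> _ _ g4 = 4 , ≤-refl , g4 , l5

  -- An occurrence whose boundary is shaded uses the first and last position and the least and
  -- greatest value: an unused one would be a point of the permutation in a shaded box.
  module ShadedOccurrence {n : ℕ} {τ : List ℕ} (perm : IsPerm n τ)
    (i1 i2 i3 i4 : ℕ) (1≤i1 : 1 ≤ i1) (i1<i2 : i1 < i2) (i2<i3 : i2 < i3) (i3<i4 : i3 < i4) (i4≤n : i4 ≤ n)
    (v1 v2 v3 v4 : ℕ) (sorted : sort (map (at τ) (i1 ∷ i2 ∷ i3 ∷ i4 ∷ [])) ≡ v1 ∷ v2 ∷ v3 ∷ v4 ∷ [])
    (v1<v2 : v1 < v2) (v2<v3 : v2 < v3) (v3<v4 : v3 < v4)
    (v⇒u : ∀ w → Among4 w v1 v2 v3 v4 → Among4 w (at τ i1) (at τ i2) (at τ i3) (at τ i4))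
    (u⇒v : ∀ w → Among4 w (at τ i1) (at τ i2) (at τ i3) (at τ i4) → Among4 w v1 v2 v3 v4)
    (shaded : all (emptyBox n τ (i1 ∷ i2 ∷ i3 ∷ i4 ∷ [])) boundary4 ≡ true) where

    open IsPerm perm

    is : List ℕ
    is = i1 ∷ i2 ∷ i3 ∷ i4 ∷ []

    VE : (k : ℕ) → V n τ is k ≡ nth0 (0 ∷ v1 ∷ v2 ∷ v3 ∷ v4 ∷ suc n ∷ []) k
    VE = V-sorted n τ is sorted

    i1≤i2 : i1 ≤ i2
    i1≤i2 = <⇒≤ i1<i2
    i1≤i3 : i1 ≤ i3
    i1≤i3 = <⇒≤ (<-trans i1<i2 i2<i3)
    i1≤i4 : i1 ≤ i4
    i1≤i4 = <⇒≤ (<-trans i1<i2 (<-trans i2<i3 i3<i4))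
    i1≤n : i1 ≤ n
    i1≤n = ≤-trans i1≤i4 i4≤n
    i2≤n : i2 ≤ n
    i2≤n = ≤-trans (<⇒≤ (<-trans i2<i3 i3<i4)) i4≤n
    i3≤n : i3 ≤ n
    i3≤n = ≤-trans (<⇒≤ i3<i4) i4≤n
    1≤n : 1 ≤ n
    1≤n = ≤-trans 1≤i1 i1≤n

    unusedValue : (p : ℕ) → 1 ≤ p → p ≤ n → p ≢ i1 → p ≢ i2 → p ≢ i3 → p ≢ i4 → Among4 (at τ p) v1 v2 v3 v4 → ⊥
    unusedValue p 1≤p p≤n n1 n2 n3 n4 am with v⇒u (at τ p) am
    ... | inj₁ e = n1 (at-injective-perm p i1 1≤p p≤n 1≤i1 i1≤n e)
    ... | inj₂ (inj₁ e) = n2 (at-injective-perm p i2 1≤p p≤n (≤-trans 1≤i1 i1≤i2) i2≤n e)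
    ... | inj₂ (inj₂ (inj₁ e)) = n3 (at-injective-perm p i3 1≤p p≤n (≤-trans 1≤i1 i1≤i3) i3≤n e)
    ... | inj₂ (inj₂ (inj₂ e)) = n4 (at-injective-perm p i4 1≤p p≤n (≤-trans 1≤i1 i1≤i4) i4≤n e)

    usedValue-bounds : (w : ℕ) → Among4 w v1 v2 v3 v4 → v1 ≤ w × w ≤ v4
    usedValue-bounds w (inj₁ refl) = ≤-refl , <⇒≤ (<-trans v1<v2 (<-trans v2<v3 v3<v4))
    usedValue-bounds w (inj₂ (inj₁ refl)) = <⇒≤ v1<v2 , <⇒≤ (<-trans v2<v3 v3<v4)
    usedValue-bounds w (inj₂ (inj₂ (inj₁ refl))) = <⇒≤ (<-trans v1<v2 v2<v3) , <⇒≤ v3<v4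
    usedValue-bounds w (inj₂ (inj₂ (inj₂ refl))) = <⇒≤ (<-trans v1<v2 (<-trans v2<v3 v3<v4)) , ≤-refl

    usedPosition-bounds : (k : ℕ) → Among4 k i1 i2 i3 i4 → v1 ≤ at τ k × at τ k ≤ v4
    usedPosition-bounds k (inj₁ refl) = usedValue-bounds _ (u⇒v _ (inj₁ refl))
    usedPosition-bounds k (inj₂ (inj₁ refl)) = usedValue-bounds _ (u⇒v _ (inj₂ (inj₁ refl)))
    usedPosition-bounds k (inj₂ (inj₂ (inj₁ refl))) = usedValue-bounds _ (u⇒v _ (inj₂ (inj₂ (inj₁ refl))))
    usedPosition-bounds k (inj₂ (inj₂ (inj₂ refl))) = usedValue-bounds _ (u⇒v _ (inj₂ (inj₂ (inj₂ refl))))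

    usedValue-range : (w : ℕ) → Among4 w v1 v2 v3 v4 → 1 ≤ w × w ≤ n
    usedValue-range w am with v⇒u w am
    ... | inj₁ refl = rng i1 1≤i1 i1≤n
    ... | inj₂ (inj₁ refl) = rng i2 (≤-trans 1≤i1 i1≤i2) i2≤n
    ... | inj₂ (inj₂ (inj₁ refl)) = rng i3 (≤-trans 1≤i1 i1≤i3) i3≤n
    ... | inj₂ (inj₂ (inj₂ refl)) = rng i4 (≤-trans 1≤i1 i1≤i4) i4≤n

    valueRow : (w : ℕ) → 1 ≤ w → w ≤ n → (Among4 w v1 v2 v3 v4 → ⊥) →
      Σ ℕ (λ y → y ≤ 4 × V n τ is y < w × w < V n τ is (suc y))
    valueRow w 1≤w w≤n unused = locate (V n τ is) w 1≤w (subst (w <_) (sym (VE 5)) (s≤s w≤n))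
      (λ e → unused (inj₁ (trans e (VE 1)))) (λ e → unused (inj₂ (inj₁ (trans e (VE 2)))))
      (λ e → unused (inj₂ (inj₂ (inj₁ (trans e (VE 3)))))) (λ e → unused (inj₂ (inj₂ (inj₂ (trans e (VE 4))))))

    positionColumn : (p : ℕ) → 1 ≤ p → p ≤ n → ((k : ℕ) → Among4 k i1 i2 i3 i4 → p ≢ k) →
      Σ ℕ (λ x → x ≤ 4 × I n is x < p × p < I n is (suc x))
    positionColumn p 1≤p p≤n unused = locate (I n is) p 1≤p (s≤s p≤n) (unused i1 (inj₁ refl)) (unused i2 (inj₂ (inj₁ refl)))
      (unused i3 (inj₂ (inj₂ (inj₁ refl)))) (unused i4 (inj₂ (inj₂ (inj₂ refl))))

    shadedBox-empty : (x y m : ℕ) → (x , y) ∈ boundary4 → 1 ≤ m → m ≤ n →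
      I n is x < m → m < I n is (suc x) → V n τ is y < at τ m → at τ m < V n τ is (suc y) → ⊥
    shadedBox-empty x y m xy∈ 1≤m m≤n l r b t
      with trans (sym (inBox-intro n τ is x y m l r b t))
                 (any-false⇒false (inBox n τ is (x , y)) (range 1 n)
                   (not-true (all-∈ (emptyBox n τ is) boundary4 shaded xy∈)) (∈-range⁺ 1≤m m≤n))
    ... | ()

    i1≡1 : i1 ≡ 1
    i1≡1 with i1 ≟ 1
    ... | yes e = e
    ... | no i1≢1 with valueRow (at τ 1) (proj₁ (rng 1 ≤-refl 1≤n)) (proj₂ (rng 1 ≤-refl 1≤n)) unused
      where
      1<i1 : 1 < i1
      1<i1 = ≤∧≢⇒< 1≤i1 (i1≢1 ∘ sym)
      unused = unusedValue 1 ≤-refl 1≤n (λ e → <-irrefl e 1<i1) (λ e → <-irrefl e (<-≤-trans 1<i1 i1≤i2))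
                 (λ e → <-irrefl e (<-≤-trans 1<i1 i1≤i3)) (λ e → <-irrefl e (<-≤-trans 1<i1 i1≤i4))
    ...   | y , y≤4 , b , t =
            ⊥-elim (shadedBox-empty 0 y 1 (∈-boundary4-column y (here refl) y≤4) ≤-refl 1≤n
                      (s≤s z≤n) (≤∧≢⇒< 1≤i1 (i1≢1 ∘ sym)) b t)

    i4≡n : i4 ≡ n
    i4≡n with i4 ≟ n
    ... | yes e = e
    ... | no i4≢n with valueRow (at τ n) (proj₁ (rng n 1≤n ≤-refl)) (proj₂ (rng n 1≤n ≤-refl)) unused
      where
      i4<n : i4 < n
      i4<n = ≤∧≢⇒< i4≤n i4≢n
      unused = unusedValue n 1≤n ≤-refl (λ e → <-irrefl (sym e) (≤-<-trans i1≤i4 i4<n))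
                 (λ e → <-irrefl (sym e) (<-trans (<-trans i2<i3 i3<i4) i4<n))
                 (λ e → <-irrefl (sym e) (<-trans i3<i4 i4<n)) (λ e → <-irrefl (sym e) i4<n)
    ...   | y , y≤4 , b , t =
            ⊥-elim (shadedBox-empty 4 y n (∈-boundary4-column y (there (here refl)) y≤4) 1≤n ≤-refl
                      (≤∧≢⇒< i4≤n i4≢n) (n<1+n n) b t)

    v1≡1 : v1 ≡ 1
    v1≡1 with v1 ≟ 1
    ... | yes e = e
    ... | no v1≢1 with surj 1 ≤-refl (≤-trans (proj₁ (usedValue-range v1 (inj₁ refl))) (proj₂ (usedValue-range v1 (inj₁ refl))))
    ...   | p , (1≤p , p≤n) , τp≡1 with positionColumn p 1≤p p≤n unused
      where
      1<v1 : 1 < v1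
      1<v1 = ≤∧≢⇒< (proj₁ (usedValue-range v1 (inj₁ refl))) (v1≢1 ∘ sym)
      unused : (k : ℕ) → Among4 k i1 i2 i3 i4 → p ≢ k
      unused k used refl = <-irrefl refl (<-≤-trans 1<v1 (subst (v1 ≤_) τp≡1 (proj₁ (usedPosition-bounds k used))))
    ...     | x , x≤4 , l , r =
              ⊥-elim (shadedBox-empty x 0 p (∈-boundary4-row x x≤4 (here refl)) 1≤p p≤n l r
                        (subst (0 <_) (sym τp≡1) (s≤s z≤n))
                        (subst₂ _<_ (sym τp≡1) (sym (VE 1)) (≤∧≢⇒< (proj₁ (usedValue-range v1 (inj₁ refl))) (v1≢1 ∘ sym))))

    v4≡n : v4 ≡ n
    v4≡n with v4 ≟ n
    ... | yes e = e
    ... | no v4≢n with surj n (≤-trans (proj₁ (usedValue-range v4 top)) (proj₂ (usedValue-range v4 top))) ≤-refl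
      where
      top : Among4 v4 v1 v2 v3 v4
      top = inj₂ (inj₂ (inj₂ refl))
    ...   | p , (1≤p , p≤n) , τp≡n with positionColumn p 1≤p p≤n unused
      where
      v4<n : v4 < n
      v4<n = ≤∧≢⇒< (proj₂ (usedValue-range v4 (inj₂ (inj₂ (inj₂ refl))))) v4≢n
      unused : (k : ℕ) → Among4 k i1 i2 i3 i4 → p ≢ k
      unused k used refl = <-irrefl refl (≤-<-trans (subst (_≤ v4) τp≡n (proj₂ (usedPosition-bounds k used))) v4<n)
    ...     | x , x≤4 , l , r =
              ⊥-elim (shadedBox-empty x 4 p (∈-boundary4-row x x≤4 (there (here refl))) 1≤p p≤n l r
                        (subst₂ _<_ (sym (VE 4)) (sym τp≡n) (≤∧≢⇒< (proj₂ (usedValue-range v4 (inj₂ (inj₂ (inj₂ refl))))) v4≢n))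
                        (subst₂ _<_ (sym τp≡n) (sym (VE 5)) (n<1+n n)))

  orderIsoᵛ : List ℕ → List ℕ → Bool
  orderIsoᵛ π us = all (λ a → all (λ b → (at us a <ᵇ at us b) == (at π a <ᵇ at π b)) (range 1 4)) (range 1 4)

  orderIsoᵛ⇒< : (π us : List ℕ) → orderIsoᵛ π us ≡ true → {a b : ℕ} → a ∈ range 1 4 → b ∈ range 1 4 →
    (at π a <ᵇ at π b) ≡ true → at us a < at us b
  orderIsoᵛ⇒< π us iso {a} {b} a∈ b∈ πa<πb =
    <ᵇ-sound (==-true (subst (λ c → ((at us a <ᵇ at us b) == c) ≡ true) πa<πb
      (all-∈ (λ b → (at us a <ᵇ at us b) == (at π a <ᵇ at π b)) (range 1 4)
        (all-∈ (λ a → all (λ b → (at us a <ᵇ at us b) == (at π a <ᵇ at π b)) (range 1 4)) (range 1 4) iso a∈) b∈)))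

  1∈ : 1 ∈ range 1 4
  1∈ = here refl

  2∈ : 2 ∈ range 1 4
  2∈ = there (here refl)

  3∈ : 3 ∈ range 1 4
  3∈ = there (there (here refl))

  4∈ : 4 ∈ range 1 4
  4∈ = there (there (there (here refl)))

  -- An occurrence of 2143 reads (a , 1 , n , L) with a < L; maxFirst exchanges 1 and n (2413),
  -- descending asks for a > L (3142), both together give 3412.
  firstMarker : Bool → ℕ → ℕ
  firstMarker maxFirst n = if maxFirst then n else 1

  secondMarker : Bool → ℕ → ℕ
  secondMarker maxFirst n = if maxFirst then 1 else n

  compareBy : Bool → ℕ → ℕ → Bool
  compareBy descending a v = if descending then v <ᵇ a else a <ᵇ v

  record ValueOrder (n : ℕ) (maxFirst descending : Bool) (u1 u2 u3 u4 : ℕ) : Set where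
    field
      v1 v2 v3 v4 : ℕ
      sorted : sort (u1 ∷ u2 ∷ u3 ∷ u4 ∷ []) ≡ v1 ∷ v2 ∷ v3 ∷ v4 ∷ []
      v1<v2 : v1 < v2
      v2<v3 : v2 < v3
      v3<v4 : v3 < v4
      v⇒u : ∀ w → Among4 w v1 v2 v3 v4 → Among4 w u1 u2 u3 u4
      u⇒v : ∀ w → Among4 w u1 u2 u3 u4 → Among4 w v1 v2 v3 v4
      extremes : v1 ≡ 1 → v4 ≡ n →
        (u2 ≡ firstMarker maxFirst n) × (u3 ≡ secondMarker maxFirst n) ×
        (1 < u1) × (u1 < n) × (1 < u4) × (u4 < n) × (compareBy descending u1 u4 ≡ true)

  record PatternData (π : List ℕ) (maxFirst descending : Bool) : Set where
    field
      realise : (n a L : ℕ) → 1 < a → a < n → 1 < L → L < n → compareBy descending a L ≡ true →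
        orderIsoᵛ π (a ∷ firstMarker maxFirst n ∷ secondMarker maxFirst n ∷ L ∷ []) ≡ true ×
        Σ ℕ (λ b → Σ ℕ (λ c → sort (a ∷ firstMarker maxFirst n ∷ secondMarker maxFirst n ∷ L ∷ []) ≡ 1 ∷ b ∷ c ∷ n ∷ []))
      analyse : (n u1 u2 u3 u4 : ℕ) → orderIsoᵛ π (u1 ∷ u2 ∷ u3 ∷ u4 ∷ []) ≡ true →
        ValueOrder n maxFirst descending u1 u2 u3 u4

  Extreme : ℕ → ℕ → Set
  Extreme n z = (z ≡ 1) ⊎ (z ≡ n)

  firstMarker-extreme : (maxFirst : Bool) (n : ℕ) → Extreme n (firstMarker maxFirst n)
  firstMarker-extreme true n = inj₂ refl
  firstMarker-extreme false n = inj₁ refl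

  secondMarker-extreme : (maxFirst : Bool) (n : ℕ) → Extreme n (secondMarker maxFirst n)
  secondMarker-extreme true n = inj₁ refl
  secondMarker-extreme false n = inj₂ refl

  Extreme-bounds : {n z : ℕ} → 1 ≤ n → Extreme n z → 1 ≤ z × z ≤ n
  Extreme-bounds 1≤n (inj₁ refl) = ≤-refl , 1≤n
  Extreme-bounds 1≤n (inj₂ refl) = 1≤n , ≤-refl

  interior≢Extreme : {n z a : ℕ} → Extreme n z → 1 < a → a < n → a ≢ z
  interior≢Extreme (inj₁ refl) 1<a a<n refl = <-irrefl refl 1<a
  interior≢Extreme (inj₂ refl) 1<a a<n refl = <-irrefl refl a<n

  record Framing (n x y : ℕ) (cmp : ℕ → ℕ → Bool) (τ : List ℕ) : Set where
    field
      i j : ℕ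
      1<i : 1 < i
      i<j : i < j
      j<n : j < n
      at-i : at τ i ≡ x
      at-j : at τ j ≡ y
      1<first : 1 < at τ 1
      first<n : at τ 1 < n
      1<last : 1 < at τ n
      last<n : at τ n < n
      related : cmp (at τ 1) (at τ n) ≡ true

  ∸1-mono-< : {p q : ℕ} → 1 ≤ p → p < q → p ∸ 1 < q ∸ 1
  ∸1-mono-< {suc p} {suc q} _ (s≤s p<q) = p<q

  Framing⇒framed : {n x y : ℕ} {cmp : ℕ → ℕ → Bool} {τ : List ℕ} → IsPerm n τ → Framing n x y cmp τ →
    framed n x y cmp τ ≡ true
  Framing⇒framed {n} {x} {y} {cmp} {a ∷ w} perm fr = byPositions positionX positionY
    where
    open Framing fr
    open IsPerm perm using (len; position-at-perm)
    positionX : position x (a ∷ w) ≡ i ∸ 1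
    positionX = trans (cong (λ z → position z (a ∷ w)) (sym at-i))
      (position-at-perm i (<⇒≤ 1<i) (<⇒≤ (<-trans i<j j<n)))
    positionY : position y (a ∷ w) ≡ j ∸ 1
    positionY = trans (cong (λ z → position z (a ∷ w)) (sym at-j))
      (position-at-perm j (<⇒≤ (<-trans 1<i i<j)) (<⇒≤ j<n))
    byPositions : position x (a ∷ w) ≡ i ∸ 1 → position y (a ∷ w) ≡ j ∸ 1 → framed n x y cmp (a ∷ w) ≡ true
    byPositions px py
      rewrite last-at a w | len | <ᵇ-true 1<first | <ᵇ-true first<n | <ᵇ-true 1<last | <ᵇ-true last<n
            | related | px | py = <ᵇ-true (∸1-mono-< (<⇒≤ 1<i) i<j)

  framed⇒Framing : {n x y : ℕ} {cmp : ℕ → ℕ → Bool} {τ : List ℕ} → IsPerm n τ → 1 ≤ n → Extreme n x → Extreme n y →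
    framed n x y cmp τ ≡ true → Framing n x y cmp τ
  framed⇒Framing {n} {x} {y} {cmp} {a ∷ w} perm 1≤n extX extY fr
    with surj x (proj₁ (Extreme-bounds 1≤n extX)) (proj₂ (Extreme-bounds 1≤n extX))
       | surj y (proj₁ (Extreme-bounds 1≤n extY)) (proj₂ (Extreme-bounds 1≤n extY))
    where open IsPerm perm
  ... | i , (1≤i , i≤n) , at-i | j , (1≤j , j≤n) , at-j = record
    { i = i ; j = j
    ; 1<i = ≤∧≢⇒< 1≤i (λ 1≡i → interior≢Extreme extX 1<a a<n (trans (cong (at τ) 1≡i) at-i))
    ; i<j = i<j
    ; j<n = ≤∧≢⇒< j≤n (λ j≡n → interior≢Extreme extY 1<L L<n (trans (cong (at τ) (sym j≡n)) at-j))
    ; at-i = at-i ; at-j = at-j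
    ; 1<first = 1<a ; first<n = a<n ; 1<last = 1<L ; last<n = L<n
    ; related = subst (λ z → cmp a z ≡ true) lastL (∧-conicalʳ (interior n (last τ)) _ lastOK)
    }
    where
    open IsPerm perm
    τ = a ∷ w
    firstOK : interior n a ≡ true
    firstOK = ∧-conicalˡ _ _ fr
    rest : lastAndBefore (interiorBy n cmp a) x y τ ≡ true
    rest = ∧-conicalʳ (interior n a) _ fr
    lastOK : interiorBy n cmp a (last τ) ≡ true
    lastOK = ∧-conicalˡ _ _ rest
    lastL : last τ ≡ at τ n
    lastL = trans (last-at a w) (cong (at τ) len)
    lastInterior : interior n (at τ n) ≡ true
    lastInterior = subst (λ z → interior n z ≡ true) lastL (∧-conicalˡ _ _ lastOK)
    1<a = <ᵇ-sound (∧-conicalˡ _ _ firstOK)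
    a<n = <ᵇ-sound (∧-conicalʳ (1 <ᵇ a) _ firstOK)
    1<L = <ᵇ-sound (∧-conicalˡ _ _ lastInterior)
    L<n = <ᵇ-sound (∧-conicalʳ (1 <ᵇ at τ n) _ lastInterior)
    i<j : i < j
    i<j with position-at-perm i 1≤i i≤n | position-at-perm j 1≤j j≤n
    ... | pi | pj = ∸1-cancel-< 1≤i 1≤j
      (<ᵇ-sound (trans (sym (cong₂ _<ᵇ_ (trans (cong (λ z → position z τ) (sym at-i)) pi)
                                       (trans (cong (λ z → position z τ) (sym at-j)) pj)))
                       (∧-conicalʳ (interiorBy n cmp a (last τ)) _ rest)))
      where
      ∸1-cancel-< : {p q : ℕ} → 1 ≤ p → 1 ≤ q → p ∸ 1 < q ∸ 1 → p < q
      ∸1-cancel-< {suc p} {suc q} _ _ p<q = s≤s p<q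

  increasing-1ijn : {i j n : ℕ} → 1 < i → i < j → j < n → increasing (1 ∷ i ∷ j ∷ n ∷ []) ≡ true
  increasing-1ijn 1<i i<j j<n rewrite <ᵇ-true 1<i | <ᵇ-true i<j | <ᵇ-true j<n = refl

  module Characterisation (p1 p2 p3 p4 : ℕ) {maxFirst descending : Bool}
    (pd : PatternData (p1 ∷ p2 ∷ p3 ∷ p4 ∷ []) maxFirst descending) (n : ℕ) (4≤n : 4 ≤ n) where

    π : List ℕ
    π = p1 ∷ p2 ∷ p3 ∷ p4 ∷ []

    X Y : ℕ
    X = firstMarker maxFirst n
    Y = secondMarker maxFirst n

    cmp : ℕ → ℕ → Bool
    cmp = compareBy descending

    1≤n : 1 ≤ n
    1≤n = ≤-trans (s≤s z≤n) 4≤n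

    candidates : List (List ℕ)
    candidates = filterᵇ increasing (words 4 (range 1 n))

    Framing⇒contains : (τ : List ℕ) → Framing n X Y cmp τ → contains n (π , boundary4) τ ≡ true
    Framing⇒contains τ fr = ∈⇒any (isOccurrence n τ (π , boundary4)) candidates chosen (cong₂ _∧_ isomorphic shaded)
      where
      open Framing fr
      realised = PatternData.realise pd n (at τ 1) (at τ n) 1<first first<n 1<last last<n related
      is : List ℕ
      is = 1 ∷ i ∷ j ∷ n ∷ []
      chosen : is ∈ candidates
      chosen = ∈-filterᵇ⁺ {p = increasing} (words 4 (range 1 n))
        (∈-words⁺ 4 (range 1 n) is refl
          (∈-range⁺ ≤-refl 1≤n ∷ ∈-range⁺ (<⇒≤ 1<i) (<⇒≤ (<-trans i<j j<n)) ∷ ∈-range⁺ (<⇒≤ (<-trans 1<i i<j)) (<⇒≤ j<n)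
            ∷ ∈-range⁺ 1≤n ≤-refl ∷ []))
        (increasing-1ijn 1<i i<j j<n)
      isomorphic : orderIso τ π is n ≡ true
      isomorphic = trans (cong₂ (λ s t → orderIsoᵛ π (at τ 1 ∷ s ∷ t ∷ at τ n ∷ [])) at-i at-j) (proj₁ realised)
      shaded : all (emptyBox n τ is) boundary4 ≡ true
      shaded = boundary4-empty n τ i j _ _
        (trans (cong₂ (λ s t → sort (at τ 1 ∷ s ∷ t ∷ at τ n ∷ [])) at-i at-j) (proj₂ (proj₂ (proj₂ realised))))

    contains⇒Framing : (τ : List ℕ) → IsPerm n τ → contains n (π , boundary4) τ ≡ true → Framing n X Y cmp τ
    contains⇒Framing τ perm occ with any⇒∈ (isOccurrence n τ (π , boundary4)) candidates occ
    ... | is , is∈ , isOcc with ∈-filterᵇ⁻ {p = increasing} (words 4 (range 1 n)) is∈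
    ...   | is∈words , inc with ∈-words⁻ 4 (range 1 n) is is∈words
    ...     | len , inRange = fromPositions is len inRange inc isOcc
      where
      fromPositions : (is : List ℕ) → length is ≡ 4 → All (_∈ range 1 n) is → increasing is ≡ true →
        isOccurrence n τ (π , boundary4) is ≡ true → Framing n X Y cmp τ
      fromPositions (i1 ∷ i2 ∷ i3 ∷ i4 ∷ []) refl (i1∈ ∷ _ ∷ _ ∷ i4∈ ∷ []) inc occ = build (extremes v1≡1 v4≡n)
        where
        i1<i2 = <ᵇ-sound (∧-conicalˡ _ _ inc)
        i2<i3 = <ᵇ-sound (∧-conicalˡ _ _ (∧-conicalʳ (i1 <ᵇ i2) _ inc))
        i3<i4 = <ᵇ-sound (∧-conicalˡ _ _ (∧-conicalʳ (i2 <ᵇ i3) _ (∧-conicalʳ (i1 <ᵇ i2) _ inc)))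
        ordered = PatternData.analyse pd n (at τ i1) (at τ i2) (at τ i3) (at τ i4) (∧-conicalˡ _ _ occ)
        open ValueOrder ordered
        open ShadedOccurrence perm i1 i2 i3 i4 (proj₁ (∈-range⁻ i1∈)) i1<i2 i2<i3 i3<i4 (proj₂ (∈-range⁻ i4∈))
          v1 v2 v3 v4 sorted v1<v2 v2<v3 v3<v4 v⇒u u⇒v (∧-conicalʳ (orderIso τ π (i1 ∷ i2 ∷ i3 ∷ i4 ∷ []) n) _ occ)
        build : (at τ i2 ≡ X) × (at τ i3 ≡ Y) × (1 < at τ i1) × (at τ i1 < n) × (1 < at τ i4) × (at τ i4 < n) ×
          (cmp (at τ i1) (at τ i4) ≡ true) → Framing n X Y cmp τ
        build (at-i2 , at-i3 , 1<u1 , u1<n , 1<u4 , u4<n , rel) = record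
          { i = i2 ; j = i3
          ; 1<i = subst (_< i2) i1≡1 i1<i2 ; i<j = i2<i3 ; j<n = subst (i3 <_) i4≡n i3<i4
          ; at-i = at-i2 ; at-j = at-i3
          ; 1<first = subst (λ k → 1 < at τ k) i1≡1 1<u1 ; first<n = subst (λ k → at τ k < n) i1≡1 u1<n
          ; 1<last = subst (λ k → 1 < at τ k) i4≡n 1<u4 ; last<n = subst (λ k → at τ k < n) i4≡n u4<n
          ; related = subst₂ (λ k l → cmp (at τ k) (at τ l) ≡ true) i1≡1 i4≡n rel
          }

    contains≡framed : (τ : List ℕ) → τ ∈ S n → contains n (π , boundary4) τ ≡ framed n X Y cmp τ
    contains≡framed τ τ∈ = Bool-iff
      (Framing⇒framed perm ∘ contains⇒Framing τ perm)
      (Framing⇒contains τ ∘ framed⇒Framing perm 1≤n (firstMarker-extreme maxFirst n) (secondMarker-extreme maxFirst n))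
      where
      perm = S⇒IsPerm n τ τ∈

  pattern-2143 : PatternData (2 ∷ 1 ∷ 4 ∷ 3 ∷ []) false false
  pattern-2143 = record { realise = realise ; analyse = analyse }
    where
    order : {u1 u2 u3 u4 : ℕ} → u2 < u1 → u1 < u4 → u4 < u3 →
      orderIsoᵛ (2 ∷ 1 ∷ 4 ∷ 3 ∷ []) (u1 ∷ u2 ∷ u3 ∷ u4 ∷ []) ≡ true
    order {u1} {u2} {u3} {u4} c1 c2 c3
      rewrite <ᵇ-irrefl u1 | <ᵇ-false {u1} {u2} (<⇒≤ c1) | <ᵇ-true {u1} {u3} (<-trans c2 c3)
            | <ᵇ-true {u1} {u4} c2 | <ᵇ-true {u2} {u1} c1 | <ᵇ-irrefl u2
            | <ᵇ-true {u2} {u3} (<-trans c1 (<-trans c2 c3)) | <ᵇ-true {u2} {u4} (<-trans c1 c2) | <ᵇ-false {u3} {u1} (<⇒≤ (<-trans c2 c3))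
            | <ᵇ-false {u3} {u2} (<⇒≤ (<-trans c1 (<-trans c2 c3))) | <ᵇ-irrefl u3 | <ᵇ-false {u3} {u4} (<⇒≤ c3)
            | <ᵇ-false {u4} {u1} (<⇒≤ c2) | <ᵇ-false {u4} {u2} (<⇒≤ (<-trans c1 c2)) | <ᵇ-true {u4} {u3} c3
            | <ᵇ-irrefl u4 = refl
    sorted : {u1 u2 u3 u4 : ℕ} → u2 < u1 → u1 < u4 → u4 < u3 →
      sort (u1 ∷ u2 ∷ u3 ∷ u4 ∷ []) ≡ u2 ∷ u1 ∷ u4 ∷ u3 ∷ []
    sorted {u1} {u2} {u3} {u4} c1 c2 c3
      rewrite <ᵇ-false {u3} {suc u4} c3 | <ᵇ-true {u2} {suc u4} (s≤s (<⇒≤ (<-trans c1 c2))) | <ᵇ-false {u1} {suc u2} c1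
            | <ᵇ-true {u1} {suc u4} (s≤s (<⇒≤ c2)) = refl
    realise : (n a L : ℕ) → 1 < a → a < n → 1 < L → L < n → compareBy false a L ≡ true →
      orderIsoᵛ (2 ∷ 1 ∷ 4 ∷ 3 ∷ []) (a ∷ firstMarker false n ∷ secondMarker false n ∷ L ∷ []) ≡ true ×
      Σ ℕ (λ b → Σ ℕ (λ c → sort (a ∷ firstMarker false n ∷ secondMarker false n ∷ L ∷ []) ≡ 1 ∷ b ∷ c ∷ n ∷ []))
    realise n a L 1<a a<n 1<L L<n a<L =
      order {a} {1} {n} {L} 1<a (<ᵇ-sound a<L) L<n , a , L , sorted {a} {1} {n} {L} 1<a (<ᵇ-sound a<L) L<n
    analyse : (n u1 u2 u3 u4 : ℕ) → orderIsoᵛ (2 ∷ 1 ∷ 4 ∷ 3 ∷ []) (u1 ∷ u2 ∷ u3 ∷ u4 ∷ []) ≡ true →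
      ValueOrder n false false u1 u2 u3 u4
    analyse n u1 u2 u3 u4 iso = record
      { v1 = u2 ; v2 = u1 ; v3 = u4 ; v4 = u3 ; sorted = sorted c1 c2 c3
      ; v1<v2 = c1 ; v2<v3 = c2 ; v3<v4 = c3 ; v⇒u = v⇒u ; u⇒v = u⇒v ; extremes = extremes }
      where
      c1 = orderIsoᵛ⇒< (2 ∷ 1 ∷ 4 ∷ 3 ∷ []) (u1 ∷ u2 ∷ u3 ∷ u4 ∷ []) iso 2∈ 1∈ refl
      c2 = orderIsoᵛ⇒< (2 ∷ 1 ∷ 4 ∷ 3 ∷ []) (u1 ∷ u2 ∷ u3 ∷ u4 ∷ []) iso 1∈ 4∈ refl
      c3 = orderIsoᵛ⇒< (2 ∷ 1 ∷ 4 ∷ 3 ∷ []) (u1 ∷ u2 ∷ u3 ∷ u4 ∷ []) iso 4∈ 3∈ refl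
      v⇒u : ∀ w → Among4 w u2 u1 u4 u3 → Among4 w u1 u2 u3 u4
      v⇒u w (inj₁ e) = inj₂ (inj₁ e)
      v⇒u w (inj₂ (inj₁ e)) = inj₁ e
      v⇒u w (inj₂ (inj₂ (inj₁ e))) = inj₂ (inj₂ (inj₂ e))
      v⇒u w (inj₂ (inj₂ (inj₂ e))) = inj₂ (inj₂ (inj₁ e))
      u⇒v : ∀ w → Among4 w u1 u2 u3 u4 → Among4 w u2 u1 u4 u3
      u⇒v w (inj₁ e) = inj₂ (inj₁ e)
      u⇒v w (inj₂ (inj₁ e)) = inj₁ e
      u⇒v w (inj₂ (inj₂ (inj₁ e))) = inj₂ (inj₂ (inj₂ e))
      u⇒v w (inj₂ (inj₂ (inj₂ e))) = inj₂ (inj₂ (inj₁ e))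
      extremes : u2 ≡ 1 → u3 ≡ n →
        (u2 ≡ firstMarker false n) × (u3 ≡ secondMarker false n) × (1 < u1) × (u1 < n) × (1 < u4) × (u4 < n) ×
        (compareBy false u1 u4 ≡ true)
      extremes e1 e4 =
        e1 , e4 , subst (_< u1) e1 c1 , subst (u1 <_) e4 (<-trans c2 c3) , subst (_< u4) e1 (<-trans c1 c2) ,
          subst (u4 <_) e4 c3 , <ᵇ-true c2

  pattern-2413 : PatternData (2 ∷ 4 ∷ 1 ∷ 3 ∷ []) true false
  pattern-2413 = record { realise = realise ; analyse = analyse }
    where
    order : {u1 u2 u3 u4 : ℕ} → u3 < u1 → u1 < u4 → u4 < u2 →
      orderIsoᵛ (2 ∷ 4 ∷ 1 ∷ 3 ∷ []) (u1 ∷ u2 ∷ u3 ∷ u4 ∷ []) ≡ true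
    order {u1} {u2} {u3} {u4} c1 c2 c3
      rewrite <ᵇ-irrefl u1 | <ᵇ-true {u1} {u2} (<-trans c2 c3) | <ᵇ-false {u1} {u3} (<⇒≤ c1)
            | <ᵇ-true {u1} {u4} c2 | <ᵇ-false {u2} {u1} (<⇒≤ (<-trans c2 c3)) | <ᵇ-irrefl u2
            | <ᵇ-false {u2} {u3} (<⇒≤ (<-trans c1 (<-trans c2 c3))) | <ᵇ-false {u2} {u4} (<⇒≤ c3) | <ᵇ-true {u3} {u1} c1
            | <ᵇ-true {u3} {u2} (<-trans c1 (<-trans c2 c3)) | <ᵇ-irrefl u3 | <ᵇ-true {u3} {u4} (<-trans c1 c2)
            | <ᵇ-false {u4} {u1} (<⇒≤ c2) | <ᵇ-true {u4} {u2} c3 | <ᵇ-false {u4} {u3} (<⇒≤ (<-trans c1 c2))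
            | <ᵇ-irrefl u4 = refl
    sorted : {u1 u2 u3 u4 : ℕ} → u3 < u1 → u1 < u4 → u4 < u2 →
      sort (u1 ∷ u2 ∷ u3 ∷ u4 ∷ []) ≡ u3 ∷ u1 ∷ u4 ∷ u2 ∷ []
    sorted {u1} {u2} {u3} {u4} c1 c2 c3
      rewrite <ᵇ-true {u3} {suc u4} (s≤s (<⇒≤ (<-trans c1 c2))) | <ᵇ-false {u2} {suc u3} (<-trans c1 (<-trans c2 c3)) | <ᵇ-false {u2} {suc u4} c3
            | <ᵇ-false {u1} {suc u3} c1 | <ᵇ-true {u1} {suc u4} (s≤s (<⇒≤ c2)) = refl
    realise : (n a L : ℕ) → 1 < a → a < n → 1 < L → L < n → compareBy false a L ≡ true →
      orderIsoᵛ (2 ∷ 4 ∷ 1 ∷ 3 ∷ []) (a ∷ firstMarker true n ∷ secondMarker true n ∷ L ∷ []) ≡ true ×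
      Σ ℕ (λ b → Σ ℕ (λ c → sort (a ∷ firstMarker true n ∷ secondMarker true n ∷ L ∷ []) ≡ 1 ∷ b ∷ c ∷ n ∷ []))
    realise n a L 1<a a<n 1<L L<n a<L =
      order {a} {n} {1} {L} 1<a (<ᵇ-sound a<L) L<n , a , L , sorted {a} {n} {1} {L} 1<a (<ᵇ-sound a<L) L<n
    analyse : (n u1 u2 u3 u4 : ℕ) → orderIsoᵛ (2 ∷ 4 ∷ 1 ∷ 3 ∷ []) (u1 ∷ u2 ∷ u3 ∷ u4 ∷ []) ≡ true →
      ValueOrder n true false u1 u2 u3 u4
    analyse n u1 u2 u3 u4 iso = record
      { v1 = u3 ; v2 = u1 ; v3 = u4 ; v4 = u2 ; sorted = sorted c1 c2 c3
      ; v1<v2 = c1 ; v2<v3 = c2 ; v3<v4 = c3 ; v⇒u = v⇒u ; u⇒v = u⇒v ; extremes = extremes }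
      where
      c1 = orderIsoᵛ⇒< (2 ∷ 4 ∷ 1 ∷ 3 ∷ []) (u1 ∷ u2 ∷ u3 ∷ u4 ∷ []) iso 3∈ 1∈ refl
      c2 = orderIsoᵛ⇒< (2 ∷ 4 ∷ 1 ∷ 3 ∷ []) (u1 ∷ u2 ∷ u3 ∷ u4 ∷ []) iso 1∈ 4∈ refl
      c3 = orderIsoᵛ⇒< (2 ∷ 4 ∷ 1 ∷ 3 ∷ []) (u1 ∷ u2 ∷ u3 ∷ u4 ∷ []) iso 4∈ 2∈ refl
      v⇒u : ∀ w → Among4 w u3 u1 u4 u2 → Among4 w u1 u2 u3 u4
      v⇒u w (inj₁ e) = inj₂ (inj₂ (inj₁ e))
      v⇒u w (inj₂ (inj₁ e)) = inj₁ e
      v⇒u w (inj₂ (inj₂ (inj₁ e))) = inj₂ (inj₂ (inj₂ e))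
      v⇒u w (inj₂ (inj₂ (inj₂ e))) = inj₂ (inj₁ e)
      u⇒v : ∀ w → Among4 w u1 u2 u3 u4 → Among4 w u3 u1 u4 u2
      u⇒v w (inj₁ e) = inj₂ (inj₁ e)
      u⇒v w (inj₂ (inj₁ e)) = inj₂ (inj₂ (inj₂ e))
      u⇒v w (inj₂ (inj₂ (inj₁ e))) = inj₁ e
      u⇒v w (inj₂ (inj₂ (inj₂ e))) = inj₂ (inj₂ (inj₁ e))
      extremes : u3 ≡ 1 → u2 ≡ n →
        (u2 ≡ firstMarker true n) × (u3 ≡ secondMarker true n) × (1 < u1) × (u1 < n) × (1 < u4) × (u4 < n) ×
        (compareBy false u1 u4 ≡ true)
      extremes e1 e4 =
        e4 , e1 , subst (_< u1) e1 c1 , subst (u1 <_) e4 (<-trans c2 c3) , subst (_< u4) e1 (<-trans c1 c2) ,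
          subst (u4 <_) e4 c3 , <ᵇ-true c2

  pattern-3142 : PatternData (3 ∷ 1 ∷ 4 ∷ 2 ∷ []) false true
  pattern-3142 = record { realise = realise ; analyse = analyse }
    where
    order : {u1 u2 u3 u4 : ℕ} → u2 < u4 → u4 < u1 → u1 < u3 →
      orderIsoᵛ (3 ∷ 1 ∷ 4 ∷ 2 ∷ []) (u1 ∷ u2 ∷ u3 ∷ u4 ∷ []) ≡ true
    order {u1} {u2} {u3} {u4} c1 c2 c3
      rewrite <ᵇ-irrefl u1 | <ᵇ-false {u1} {u2} (<⇒≤ (<-trans c1 c2)) | <ᵇ-true {u1} {u3} c3
            | <ᵇ-false {u1} {u4} (<⇒≤ c2) | <ᵇ-true {u2} {u1} (<-trans c1 c2) | <ᵇ-irrefl u2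
            | <ᵇ-true {u2} {u3} (<-trans c1 (<-trans c2 c3)) | <ᵇ-true {u2} {u4} c1 | <ᵇ-false {u3} {u1} (<⇒≤ c3)
            | <ᵇ-false {u3} {u2} (<⇒≤ (<-trans c1 (<-trans c2 c3))) | <ᵇ-irrefl u3 | <ᵇ-false {u3} {u4} (<⇒≤ (<-trans c2 c3))
            | <ᵇ-true {u4} {u1} c2 | <ᵇ-false {u4} {u2} (<⇒≤ c1) | <ᵇ-true {u4} {u3} (<-trans c2 c3)
            | <ᵇ-irrefl u4 = refl
    sorted : {u1 u2 u3 u4 : ℕ} → u2 < u4 → u4 < u1 → u1 < u3 →
      sort (u1 ∷ u2 ∷ u3 ∷ u4 ∷ []) ≡ u2 ∷ u4 ∷ u1 ∷ u3 ∷ []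
    sorted {u1} {u2} {u3} {u4} c1 c2 c3
      rewrite <ᵇ-false {u3} {suc u4} (<-trans c2 c3) | <ᵇ-true {u2} {suc u4} (s≤s (<⇒≤ c1)) | <ᵇ-false {u1} {suc u2} (<-trans c1 c2)
            | <ᵇ-false {u1} {suc u4} c2 | <ᵇ-true {u1} {suc u3} (s≤s (<⇒≤ c3)) = refl
    realise : (n a L : ℕ) → 1 < a → a < n → 1 < L → L < n → compareBy true a L ≡ true →
      orderIsoᵛ (3 ∷ 1 ∷ 4 ∷ 2 ∷ []) (a ∷ firstMarker false n ∷ secondMarker false n ∷ L ∷ []) ≡ true ×
      Σ ℕ (λ b → Σ ℕ (λ c → sort (a ∷ firstMarker false n ∷ secondMarker false n ∷ L ∷ []) ≡ 1 ∷ b ∷ c ∷ n ∷ []))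
    realise n a L 1<a a<n 1<L L<n L<a =
      order {a} {1} {n} {L} 1<L (<ᵇ-sound L<a) a<n , L , a , sorted {a} {1} {n} {L} 1<L (<ᵇ-sound L<a) a<n
    analyse : (n u1 u2 u3 u4 : ℕ) → orderIsoᵛ (3 ∷ 1 ∷ 4 ∷ 2 ∷ []) (u1 ∷ u2 ∷ u3 ∷ u4 ∷ []) ≡ true →
      ValueOrder n false true u1 u2 u3 u4
    analyse n u1 u2 u3 u4 iso = record
      { v1 = u2 ; v2 = u4 ; v3 = u1 ; v4 = u3 ; sorted = sorted c1 c2 c3
      ; v1<v2 = c1 ; v2<v3 = c2 ; v3<v4 = c3 ; v⇒u = v⇒u ; u⇒v = u⇒v ; extremes = extremes }
      where
      c1 = orderIsoᵛ⇒< (3 ∷ 1 ∷ 4 ∷ 2 ∷ []) (u1 ∷ u2 ∷ u3 ∷ u4 ∷ []) iso 2∈ 4∈ refl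
      c2 = orderIsoᵛ⇒< (3 ∷ 1 ∷ 4 ∷ 2 ∷ []) (u1 ∷ u2 ∷ u3 ∷ u4 ∷ []) iso 4∈ 1∈ refl
      c3 = orderIsoᵛ⇒< (3 ∷ 1 ∷ 4 ∷ 2 ∷ []) (u1 ∷ u2 ∷ u3 ∷ u4 ∷ []) iso 1∈ 3∈ refl
      v⇒u : ∀ w → Among4 w u2 u4 u1 u3 → Among4 w u1 u2 u3 u4
      v⇒u w (inj₁ e) = inj₂ (inj₁ e)
      v⇒u w (inj₂ (inj₁ e)) = inj₂ (inj₂ (inj₂ e))
      v⇒u w (inj₂ (inj₂ (inj₁ e))) = inj₁ e
      v⇒u w (inj₂ (inj₂ (inj₂ e))) = inj₂ (inj₂ (inj₁ e))
      u⇒v : ∀ w → Among4 w u1 u2 u3 u4 → Among4 w u2 u4 u1 u3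
      u⇒v w (inj₁ e) = inj₂ (inj₂ (inj₁ e))
      u⇒v w (inj₂ (inj₁ e)) = inj₁ e
      u⇒v w (inj₂ (inj₂ (inj₁ e))) = inj₂ (inj₂ (inj₂ e))
      u⇒v w (inj₂ (inj₂ (inj₂ e))) = inj₂ (inj₁ e)
      extremes : u2 ≡ 1 → u3 ≡ n →
        (u2 ≡ firstMarker false n) × (u3 ≡ secondMarker false n) × (1 < u1) × (u1 < n) × (1 < u4) × (u4 < n) ×
        (compareBy true u1 u4 ≡ true)
      extremes e1 e4 =
        e1 , e4 , subst (_< u1) e1 (<-trans c1 c2) , subst (u1 <_) e4 c3 , subst (_< u4) e1 c1 ,
          subst (u4 <_) e4 (<-trans c2 c3) , <ᵇ-true c2

  pattern-3412 : PatternData (3 ∷ 4 ∷ 1 ∷ 2 ∷ []) true true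
  pattern-3412 = record { realise = realise ; analyse = analyse }
    where
    order : {u1 u2 u3 u4 : ℕ} → u3 < u4 → u4 < u1 → u1 < u2 →
      orderIsoᵛ (3 ∷ 4 ∷ 1 ∷ 2 ∷ []) (u1 ∷ u2 ∷ u3 ∷ u4 ∷ []) ≡ true
    order {u1} {u2} {u3} {u4} c1 c2 c3
      rewrite <ᵇ-irrefl u1 | <ᵇ-true {u1} {u2} c3 | <ᵇ-false {u1} {u3} (<⇒≤ (<-trans c1 c2))
            | <ᵇ-false {u1} {u4} (<⇒≤ c2) | <ᵇ-false {u2} {u1} (<⇒≤ c3) | <ᵇ-irrefl u2
            | <ᵇ-false {u2} {u3} (<⇒≤ (<-trans c1 (<-trans c2 c3))) | <ᵇ-false {u2} {u4} (<⇒≤ (<-trans c2 c3)) | <ᵇ-true {u3} {u1} (<-trans c1 c2)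
            | <ᵇ-true {u3} {u2} (<-trans c1 (<-trans c2 c3)) | <ᵇ-irrefl u3 | <ᵇ-true {u3} {u4} c1
            | <ᵇ-true {u4} {u1} c2 | <ᵇ-true {u4} {u2} (<-trans c2 c3) | <ᵇ-false {u4} {u3} (<⇒≤ c1)
            | <ᵇ-irrefl u4 = refl
    sorted : {u1 u2 u3 u4 : ℕ} → u3 < u4 → u4 < u1 → u1 < u2 →
      sort (u1 ∷ u2 ∷ u3 ∷ u4 ∷ []) ≡ u3 ∷ u4 ∷ u1 ∷ u2 ∷ []
    sorted {u1} {u2} {u3} {u4} c1 c2 c3
      rewrite <ᵇ-true {u3} {suc u4} (s≤s (<⇒≤ c1)) | <ᵇ-false {u2} {suc u3} (<-trans c1 (<-trans c2 c3)) | <ᵇ-false {u2} {suc u4} (<-trans c2 c3)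
            | <ᵇ-false {u1} {suc u3} (<-trans c1 c2) | <ᵇ-false {u1} {suc u4} c2 | <ᵇ-true {u1} {suc u2} (s≤s (<⇒≤ c3)) = refl
    realise : (n a L : ℕ) → 1 < a → a < n → 1 < L → L < n → compareBy true a L ≡ true →
      orderIsoᵛ (3 ∷ 4 ∷ 1 ∷ 2 ∷ []) (a ∷ firstMarker true n ∷ secondMarker true n ∷ L ∷ []) ≡ true ×
      Σ ℕ (λ b → Σ ℕ (λ c → sort (a ∷ firstMarker true n ∷ secondMarker true n ∷ L ∷ []) ≡ 1 ∷ b ∷ c ∷ n ∷ []))
    realise n a L 1<a a<n 1<L L<n L<a =
      order {a} {n} {1} {L} 1<L (<ᵇ-sound L<a) a<n , L , a , sorted {a} {n} {1} {L} 1<L (<ᵇ-sound L<a) a<n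
    analyse : (n u1 u2 u3 u4 : ℕ) → orderIsoᵛ (3 ∷ 4 ∷ 1 ∷ 2 ∷ []) (u1 ∷ u2 ∷ u3 ∷ u4 ∷ []) ≡ true →
      ValueOrder n true true u1 u2 u3 u4
    analyse n u1 u2 u3 u4 iso = record
      { v1 = u3 ; v2 = u4 ; v3 = u1 ; v4 = u2 ; sorted = sorted c1 c2 c3
      ; v1<v2 = c1 ; v2<v3 = c2 ; v3<v4 = c3 ; v⇒u = v⇒u ; u⇒v = u⇒v ; extremes = extremes }
      where
      c1 = orderIsoᵛ⇒< (3 ∷ 4 ∷ 1 ∷ 2 ∷ []) (u1 ∷ u2 ∷ u3 ∷ u4 ∷ []) iso 3∈ 4∈ refl
      c2 = orderIsoᵛ⇒< (3 ∷ 4 ∷ 1 ∷ 2 ∷ []) (u1 ∷ u2 ∷ u3 ∷ u4 ∷ []) iso 4∈ 1∈ refl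
      c3 = orderIsoᵛ⇒< (3 ∷ 4 ∷ 1 ∷ 2 ∷ []) (u1 ∷ u2 ∷ u3 ∷ u4 ∷ []) iso 1∈ 2∈ refl
      v⇒u : ∀ w → Among4 w u3 u4 u1 u2 → Among4 w u1 u2 u3 u4
      v⇒u w (inj₁ e) = inj₂ (inj₂ (inj₁ e))
      v⇒u w (inj₂ (inj₁ e)) = inj₂ (inj₂ (inj₂ e))
      v⇒u w (inj₂ (inj₂ (inj₁ e))) = inj₁ e
      v⇒u w (inj₂ (inj₂ (inj₂ e))) = inj₂ (inj₁ e)
      u⇒v : ∀ w → Among4 w u1 u2 u3 u4 → Among4 w u3 u4 u1 u2
      u⇒v w (inj₁ e) = inj₂ (inj₂ (inj₁ e))
      u⇒v w (inj₂ (inj₁ e)) = inj₂ (inj₂ (inj₂ e))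
      u⇒v w (inj₂ (inj₂ (inj₁ e))) = inj₁ e
      u⇒v w (inj₂ (inj₂ (inj₂ e))) = inj₂ (inj₁ e)
      extremes : u3 ≡ 1 → u2 ≡ n →
        (u2 ≡ firstMarker true n) × (u3 ≡ secondMarker true n) × (1 < u1) × (u1 < n) × (1 < u4) × (u4 < n) ×
        (compareBy true u1 u4 ≡ true)
      extremes e1 e4 =
        e4 , e1 , subst (_< u1) e1 (<-trans c1 c2) , subst (u1 <_) e4 c3 , subst (_< u4) e1 c1 ,
          subst (u4 <_) e4 (<-trans c2 c3) , <ᵇ-true c2


  s⁺-boundary4 : (p1 p2 p3 p4 : ℕ) {maxFirst descending : Bool} → PatternData (p1 ∷ p2 ∷ p3 ∷ p4 ∷ []) maxFirst descending →
    (n : ℕ) → 4 ≤ n → s⁺ n ((p1 ∷ p2 ∷ p3 ∷ p4 ∷ []) , boundary4) ≡ ((n ∸ 2) C 2) ^ 2 * (n ∸ 4) !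
  s⁺-boundary4 p1 p2 p3 p4 pd 0 ()
  s⁺-boundary4 p1 p2 p3 p4 pd 1 (s≤s ())
  s⁺-boundary4 p1 p2 p3 p4 pd 2 (s≤s (s≤s ()))
  s⁺-boundary4 p1 p2 p3 p4 pd 3 (s≤s (s≤s (s≤s ())))
  s⁺-boundary4 p1 p2 p3 p4 {maxFirst} {descending} pd n@(suc (suc (suc (suc m)))) 4≤n =
    trans (count-cong-∈ (S n) (λ τ τ∈ → contains≡framed τ τ∈))
      (count-framed m X Y cmp (once (firstMarker-extreme maxFirst n)) (once (secondMarker-extreme maxFirst n))
        (X≢Y maxFirst) (exterior (firstMarker-extreme maxFirst n)) (exterior (secondMarker-extreme maxFirst n))
        (cmp-irrefl descending) (pairs descending))
    where
    open Characterisation p1 p2 p3 p4 pd n 4≤n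
    once : {z : ℕ} → Extreme n z → Once z (range 1 n)
    once ext = Once-range _ n (proj₁ (Extreme-bounds 1≤n ext)) (proj₂ (Extreme-bounds 1≤n ext))
    exterior : {z : ℕ} → Extreme n z → interior n z ≡ false
    exterior (inj₁ refl) = refl
    exterior (inj₂ refl) rewrite <ᵇ-irrefl n = ∧-zeroʳ (1 <ᵇ n)
    X≢Y : (maxFirst : Bool) → firstMarker maxFirst n ≢ secondMarker maxFirst n
    X≢Y true ()
    X≢Y false ()
    cmp-irrefl : (descending : Bool) (a : ℕ) → compareBy descending a a ≡ false
    cmp-irrefl true a = <ᵇ-irrefl a
    cmp-irrefl false a = <ᵇ-irrefl a
    pairs : (descending : Bool) →
      sumMap (λ a → toℕ (interior n a) * count (interiorBy n (compareBy descending) a) (range 1 n)) (range 1 n) ≡ (n ∸ 2) C 2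
    pairs true = sumMap-interior-below n
    pairs false = sumMap-interior-above n

  s⁺-patterns : (π : List ℕ) → π ∈ patterns →
    (n : ℕ) → 4 ≤ n → s⁺ n (π , boundary4) ≡ ((n ∸ 2) C 2) ^ 2 * (n ∸ 4) !
  s⁺-patterns π (here refl) = s⁺-boundary4 2 1 4 3 pattern-2143
  s⁺-patterns π (there (here refl)) = s⁺-boundary4 2 4 1 3 pattern-2413
  s⁺-patterns π (there (there (here refl))) = s⁺-boundary4 3 1 4 2 pattern-3142
  s⁺-patterns π (there (there (there (here refl)))) = s⁺-boundary4 3 4 1 2 pattern-3412

module Density where

  open Counting using (2*C2)
  open import Data.Integer as ℤ using (ℤ; +_; -[1+_])
  import Data.Integer.Properties as ℤ
  open import Data.Nat as ℕ using (ℕ; zero; suc; _+_; _*_; _∸_; _≤_; z≤n; s≤s; _!; _^_; NonZero)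
  open import Data.Nat.Properties
  open import Data.Nat.Combinatorics using (_C_)
  open import Data.Nat.Solver using (module +-*-Solver)
  open +-*-Solver
  open import Data.Product using (_×_; _,_; ∃-syntax; proj₁; proj₂)
  open import Data.Rational as ℚ using (ℚ; mkℚ; _/_; _<_; _-_; ∣_∣; 0ℚ; toℚᵘ; fromℚᵘ; ↥_; ↧ₙ_)
  open import Data.Rational.Properties using (toℚᵘ-cancel-<; toℚᵘ-homo-∣-∣; toℚᵘ-homo-+; toℚᵘ-homo‿-; toℚᵘ-fromℚᵘ)
  open import Data.Rational.Unnormalised as ℚᵘ using (mkℚᵘ; _≃_)
  import Data.Rational.Unnormalised.Properties as ℚᵘ
  open import Relation.Binary.PropositionalEquality

  -- mkℚᵘ i d denotes i / (suc d); all estimates are made on these unnormalised fractions.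
  ∣s/F-1/4∣ᵘ : (s F′ : ℕ) → 4 * s ≤ suc F′ →
    ℚᵘ.∣ mkℚᵘ (+ s) F′ ℚᵘ.- mkℚᵘ (+ 1) 3 ∣ ≡ mkℚᵘ (+ (suc F′ ∸ 4 * s)) (3 + F′ * 4)
  ∣s/F-1/4∣ᵘ s F′ 4S≤F = cong (λ z → mkℚᵘ (+ z) (3 + F′ * 4)) (trans (cong ℤ.∣_∣ numerator) (ℤ.∣-i∣≡∣i∣ (+ (suc F′ ∸ 4 * s))))
    where
    numerator : (+ s ℤ.* + 4) ℤ.+ (-[1+ 0 ] ℤ.* + suc F′) ≡ ℤ.- (+ (suc F′ ∸ 4 * s))
    numerator =
      trans (cong₂ ℤ._+_ (trans (sym (ℤ.pos-* s 4)) (cong +_ (*-comm s 4))) (ℤ.-1*i≡-i (+ suc F′)))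
        (trans (ℤ.[+m]-[+n]≡m⊖n (4 * s) (suc F′)) (ℤ.⊖-≤ 4S≤F))

  ∣s/F-1/4∣<ε : (s F′ : ℕ) (ε : ℚ) → 0ℚ < ε → 4 * s ≤ suc F′ →
    (suc F′ ∸ 4 * s) * ↧ₙ ε ℕ.< ℤ.∣ ↥ ε ∣ * (suc F′ * 4) →
    ∣ fromℚᵘ (mkℚᵘ (+ s) F′) - (+ 1 / 4) ∣ < ε
  ∣s/F-1/4∣<ε s F′ (mkℚ (+ P) Q′ _) _ 4S≤F deficit =
    toℚᵘ-cancel-< (ℚᵘ.<-respˡ-≃ toℚᵘ-distance unnormalised)
    where
    r = fromℚᵘ (mkℚᵘ (+ s) F′)
    unnormalised : ℚᵘ.∣ mkℚᵘ (+ s) F′ ℚᵘ.- mkℚᵘ (+ 1) 3 ∣ ℚᵘ.< mkℚᵘ (+ P) Q′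
    unnormalised rewrite ∣s/F-1/4∣ᵘ s F′ 4S≤F =
      ℚᵘ.*<* (subst₂ ℤ._<_ (ℤ.pos-* (suc F′ ∸ 4 * s) (suc Q′)) (ℤ.pos-* P (suc F′ * 4)) (ℤ.+<+ deficit))
    toℚᵘ-distance : ℚᵘ.∣ mkℚᵘ (+ s) F′ ℚᵘ.- mkℚᵘ (+ 1) 3 ∣ ≃ toℚᵘ ∣ r - (+ 1 / 4) ∣
    toℚᵘ-distance = ℚᵘ.≃-sym (ℚᵘ.≃-trans (toℚᵘ-homo-∣-∣ (r - (+ 1 / 4)))
      (ℚᵘ.∣-∣-cong (ℚᵘ.≃-trans (toℚᵘ-homo-+ r (ℚ.- (+ 1 / 4)))
        (ℚᵘ.+-cong (toℚᵘ-fromℚᵘ (mkℚᵘ (+ s) F′)) (toℚᵘ-homo‿- (+ 1 / 4))))))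
  ∣s/F-1/4∣<ε s F′ (mkℚ -[1+ P ] Q′ _) (ℚ.*<* ()) 4S≤F deficit

  /-fromℚᵘ : (i : ℤ) (D : ℕ) .{{_ : NonZero D}} (F′ : ℕ) → D ≡ suc F′ → i / D ≡ fromℚᵘ (mkℚᵘ i F′)
  /-fromℚᵘ i .(suc F′) F′ refl = refl

  positive⇒1≤numerator : (ε : ℚ) → 0ℚ < ε → 1 ≤ ℤ.∣ ↥ ε ∣
  positive⇒1≤numerator (mkℚ (+ zero) _ _) (ℚ.*<* (ℤ.+<+ ()))
  positive⇒1≤numerator (mkℚ (+ suc P) _ _) _ = s≤s z≤n
  positive⇒1≤numerator (mkℚ -[1+ P ] _ _) (ℚ.*<* ())

  factorial-split : (m : ℕ) →
    (4 + m) ! ≡ 4 * (((2 + m) C 2) ^ 2 * m !) + (2 + m) ! * (4 * (2 + m) + 2)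
  factorial-split m =
    begin
      (4 + m) !
    ≡⟨ solve 2 (λ m f → (con 4 :+ m) :* ((con 3 :+ m) :* ((con 2 :+ m) :* ((con 1 :+ m) :* f)))
         := ((con 2 :+ m) :* (con 1 :+ m)) :* ((con 2 :+ m) :* (con 1 :+ m)) :* f
            :+ ((con 2 :+ m) :* ((con 1 :+ m) :* f)) :* (con 4 :* (con 2 :+ m) :+ con 2)) refl m (m !) ⟩
      ((2 + m) * (1 + m)) * ((2 + m) * (1 + m)) * m ! + (2 + m) ! * (4 * (2 + m) + 2)
    ≡⟨ cong (λ z → z * z * m ! + (2 + m) ! * (4 * (2 + m) + 2)) (sym (2*C2 m)) ⟩
      (2 * Cm) * (2 * Cm) * m ! + (2 + m) ! * (4 * (2 + m) + 2)
    ≡⟨ cong (_+ (2 + m) ! * (4 * (2 + m) + 2))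
         (solve 2 (λ c f → (con 2 :* c) :* (con 2 :* c) :* f := con 4 :* (c :* (c :* con 1) :* f)) refl Cm (m !)) ⟩
      4 * (Cm ^ 2 * m !) + (2 + m) ! * (4 * (2 + m) + 2)
    ∎
    where
    open ≡-Reasoning
    Cm = (2 + m) C 2

  -- The deficit n! − 4 s_n^+ = (n-2)! (4n − 6) is less than 4 n!/n, so the error is below 1/n.
  deficit-bound : (m Q P : ℕ) → Q ≤ m → 1 ≤ P →
    let s = ((2 + m) C 2) ^ 2 * m ! ; F = (4 + m) ! in
    (4 * s ≤ F) × ((F ∸ 4 * s) * Q ℕ.< P * (F * 4))
  deficit-bound m Q P Q≤m 1≤P = 4S≤F , deficit
    where
    n = 4 + m
    s = ((2 + m) C 2) ^ 2 * m !
    F = n !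
    g = (2 + m) !
    D = g * (4 * (2 + m) + 2)
    4S≤F : 4 * s ≤ F
    4S≤F = subst (4 * s ≤_) (sym (factorial-split m)) (m≤m+n (4 * s) D)
    F-4S≡D : F ∸ 4 * s ≡ D
    F-4S≡D = trans (cong (_∸ 4 * s) (factorial-split m)) (m+n∸m≡n (4 * s) D)
    Dn<4F : D * n ℕ.< F * 4
    Dn<4F = subst (D * n ℕ.<_)
      (solve 2 (λ m g → g :* (con 4 :* (con 2 :+ m) :+ con 2) :* (con 4 :+ m) :+ con 2 :* (con 4 :+ m) :* g
                  := (con 4 :+ m) :* ((con 3 :+ m) :* g) :* con 4) refl m g)
      (m<m+n (D * n) (*-mono-≤ {1} {2 * n} {1} {g} (s≤s z≤n) (1≤n! (2 + m))))
    deficit : (F ∸ 4 * s) * Q ℕ.< P * (F * 4)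
    deficit = subst (λ z → z * Q ℕ.< P * (F * 4)) (sym F-4S≡D)
      (≤-<-trans (*-monoʳ-≤ D (≤-trans Q≤m (m≤n+m m 4)))
        (<-≤-trans Dn<4F (subst (_≤ P * (F * 4)) (+-identityʳ (F * 4)) (*-monoˡ-≤ (F * 4) 1≤P))))

  ratio→1/4 : (p : MeshPattern) → ((n : ℕ) → 4 ≤ n → s⁺ n p ≡ ((n ∸ 2) C 2) ^ 2 * (n ∸ 4) !) →
    (ε : ℚ) → 0ℚ < ε → ∃[ N ] ((n : ℕ) → N ≤ n → ∣ ratio p n - (+ 1 / 4) ∣ < ε)
  ratio→1/4 p s⁺≡ ε 0<ε = 4 + ↧ₙ ε , close
    where
    close : (n : ℕ) → 4 + ↧ₙ ε ≤ n → ∣ ratio p n - (+ 1 / 4) ∣ < ε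
    close n@(suc (suc (suc (suc m)))) (s≤s (s≤s (s≤s (s≤s q≤m)))) =
      subst (λ r → ∣ r - (+ 1 / 4) ∣ < ε) (sym asFraction)
        (∣s/F-1/4∣<ε s F′ ε 0<ε (subst (4 * s ≤_) (sym F≡) 4S≤F)
          (subst (λ z → (z ∸ 4 * s) * ↧ₙ ε ℕ.< ℤ.∣ ↥ ε ∣ * (z * 4)) (sym F≡) deficit))
      where
      s = ((2 + m) C 2) ^ 2 * m !
      F′ = ℕ.pred (n !)
      instance
        _ : NonZero (n !)
        _ = n !≢0
      F≡ : suc F′ ≡ n !
      F≡ = suc-pred (n !)
      bounds = deficit-bound m (↧ₙ ε) ℤ.∣ ↥ ε ∣ q≤m (positive⇒1≤numerator ε 0<ε)
      4S≤F = proj₁ bounds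
      deficit = proj₂ bounds
      asFraction : ratio p n ≡ fromℚᵘ (mkℚᵘ (+ s) F′)
      asFraction = trans (cong (λ s → (+ s) / (n !)) (s⁺≡ n (s≤s (s≤s (s≤s (s≤s z≤n)))))) (/-fromℚᵘ (+ s) (n !) F′ (sym F≡))

open Containment using (s⁺-patterns)
open Density using (ratio→1/4)
open import Data.Nat using (ℕ; _≤_; _∸_; _*_; _^_; _!)
open import Data.Nat.Combinatorics using (_C_)
open import Data.Product using (_×_; _,_; ∃-syntax)
open import Data.List using (List)
open import Data.List.Membership.Propositional using (_∈_)
open import Data.Integer using (+_)
open import Data.Rational using (ℚ; _/_; _<_; _-_; ∣_∣; 0ℚ)
open import Relation.Binary.PropositionalEquality using (_≡_)

theorem4p1 : (π : List ℕ) → π ∈ patterns →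
    ((n : ℕ) → 4 ≤ n → s⁺ n (π , boundary4) ≡ ((n ∸ 2) C 2) ^ 2 * (n ∸ 4) !)
    × ((ε : ℚ) → 0ℚ < ε → ∃[ N ] ((n : ℕ) → N ≤ n → ∣ ratio (π , boundary4) n - (+ 1 / 4) ∣ < ε))
theorem4p1 π π∈patterns = s⁺-patterns π π∈patterns , ratio→1/4 (π , boundary4) (s⁺-patterns π π∈patterns)
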